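{- Let $k\ge2$. Then $\{e^0_{2k},\delta^0Y^{2k-2}\}=\dfrac{3\,b_{2k}}{2k}$, where $b_{2k}$ is the $2k$-th Bernoulli number.
   Context: $\Gamma=\mathrm{SL}_2(\mathbb Z)$, $S=\begin{pmatrix}0&-1\\1&0\end{pmatrix}$, $T=\begin{pmatrix}1&1\\0&1\end{pmatrix}$. $V_n$ is the $\mathbb Q$-space of homogeneous degree-$n$ polynomials in $X,Y$ with right action $P|_\gamma(X,Y)=P(aX+bY,cX+dY)$ for $\gamma=\begin{pmatrix}a&b\\c&d\end{pmatrix}$. For $v\in V_n$, $\delta^0v$ is the cocycle $\gamma\mapsto v|_\gamma-v$ (so $\delta^0Y^{2k-2}(S)=X^{2k-2}-Y^{2k-2}$, $\delta^0Y^{2k-2}(T)=0$). Let $c(x)=\frac1{e^x-1}+\frac12-\frac1x$. $e^0_{2k}:\Gamma\to V_{2k-2}$ is the unique $1$-cocycle ($\phi(gh)=\phi(g)|_h+\phi(h)$) such that $e^0_{2k}(S)$, resp. $e^0_{2k}(T)$, is $\frac{(2k-2)!}{2}$ times the homogeneous component of degree $2k-2$ of $c(X)c(Y)$, resp. of $\frac1Y(c(X+Y)-c(X))$. On $V_n$, $\langle\,,\rangle$ is the bilinear pairing characterised by $\langle P,(aX+bY)^n\rangle=P(-b,a)$ for all $P\in V_n$. For maps $P,Q:\Gamma\to V_n$, $\{P,Q\}=\langle P(S),Q(S)|_T-Q(S)|_{T^{ -1}}\rangle-2\langle P(T),Q(S)+Q(S)|_T\rangle$. -}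

module Defs where

open import Data.Nat as ℕ using (ℕ; zero; suc; _∸_; _!; _≤ᵇ_)
open import Data.Nat.Combinatorics using (_C_)
open import Data.Integer as ℤ using (ℤ; +_)
open import Data.Rational using (ℚ; 0ℚ; 1ℚ; _+_; _*_; _-_; -_; _/_)
open import Data.Fin using (Fin; toℕ)
open import Data.Vec as Vec using (Vec; tabulate)
open import Data.List as List using (List; []; _∷_; _++_; upTo; map; foldr)
open import Data.Bool using (if_then_else_)
open import Data.Product using (_×_; _,_)
open import Relation.Binary.PropositionalEquality using (_≡_)

ℤ→ℚ : ℤ → ℚ
ℤ→ℚ z = z / 1

ℕ→ℚ : ℕ → ℚ
ℕ→ℚ m = (+ m) / 1

-- 1/m for m ≠ 0 (and 0 for m = 0; only used with m ≠ 0)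
inv : ℕ → ℚ
inv zero    = 0ℚ
inv (suc m) = (+ 1) / suc m

_^_ : ℚ → ℕ → ℚ
q ^ zero  = 1ℚ
q ^ suc m = q * (q ^ m)

sumℚ : List ℚ → ℚ
sumℚ = foldr _+_ 0ℚ

Σ≤ : ℕ → (ℕ → ℚ) → ℚ
Σ≤ m f = sumℚ (map f (upTo (suc m)))

at : List ℚ → ℕ → ℚ
at []       _       = 0ℚ
at (x ∷ xs) zero    = x
at (x ∷ xs) (suc i) = at xs i

-- Bernoulli numbers: B_0 = 1, and Σ_{j=0}^{m} C(m+1,j) B_j = 0 for m ≥ 1,
-- i.e. B_m = -(1/(m+1)) Σ_{j=0}^{m-1} C(m+1,j) B_j  (convention B_1 = -1/2;
-- irrelevant for even index ≥ 2).

bernoulliList : ℕ → List ℚ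
bernoulliList zero    = 1ℚ ∷ []
bernoulliList (suc m) =
  let bs = bernoulliList m in
  bs ++ ((- (inv (suc (suc m)) * Σ≤ m (λ j → ℕ→ℚ (suc (suc m) C j) * at bs j))) ∷ [])

bernoulli : ℕ → ℚ
bernoulli m = at (bernoulliList m) m

-- Laurent/Taylor coefficients of c(x) = 1/(e^x - 1) + 1/2 - 1/x.
-- Write e^x - 1 = x·E(x), E(x) = Σ_n x^n/(n+1)!.  Let G = 1/E as a formal
-- power series: G_0 = 1, G_n = - Σ_{j=1}^{n} G_{n-j}/(j+1)!.
-- Then 1/(e^x-1) = Σ_n G_n x^{n-1}, so
--   c(x) = (G_0 - 1) x^{-1} + (G_1 + 1/2) + Σ_{m≥1} G_{m+1} x^m.

invEList : ℕ → List ℚ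
invEList zero    = 1ℚ ∷ []
invEList (suc m) =
  let gs = invEList m in
  gs ++ ((- Σ≤ m (λ i → at gs (m ∸ i) * inv (suc (suc i) !))) ∷ [])
  -- i = j-1 ranges over 0..m, j over 1..m+1; G_{(m+1)-j} = G_{m-i}

invE : ℕ → ℚ
invE m = at (invEList m) m

cCoeff : ℕ → ℚ
cCoeff zero    = invE 1 + ((+ 1) / 2)
cCoeff (suc m) = invE (suc (suc m))

-- V_n : homogeneous polynomials of degree n in X, Y over ℚ.
-- Entry i of the vector is the coefficient of X^i Y^(n-i).

V : ℕ → Set
V n = Vec ℚ (suc n)

coef : ∀ {n} → V n → ℕ → ℚ
coef P i = at (Vec.toList P) i

_⊕_ : ∀ {n} → V n → V n → V n
P ⊕ Q = Vec.zipWith _+_ P Q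

_⊖_ : ∀ {n} → V n → V n → V n
P ⊖ Q = Vec.zipWith _-_ P Q

Xpow Ypow : (n : ℕ) → V n
Xpow n = tabulate (λ i → if n ≤ᵇ toℕ i then 1ℚ else 0ℚ)
Ypow n = tabulate (λ i → if toℕ i ≤ᵇ 0 then 1ℚ else 0ℚ)

record Mat : Set where
  constructor mat
  field a b c d : ℤ

open Mat public

det : Mat → ℤ
det (mat a b c d) = a ℤ.* d ℤ.- b ℤ.* c

_·_ : Mat → Mat → Mat
mat a b c d · mat a' b' c' d' =
  mat (a ℤ.* a' ℤ.+ b ℤ.* c') (a ℤ.* b' ℤ.+ b ℤ.* d')
      (c ℤ.* a' ℤ.+ d ℤ.* c') (c ℤ.* b' ℤ.+ d ℤ.* d')

InΓ : Mat → Set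
InΓ g = det g ≡ + 1

Smat Tmat Tinv : Mat
Smat = mat (+ 0) (ℤ.- (+ 1)) (+ 1) (+ 0)
Tmat = mat (+ 1) (+ 1) (+ 0) (+ 1)
Tinv = mat (+ 1) (ℤ.- (+ 1)) (+ 0) (+ 1)

-- Right action P|γ (X,Y) = P(aX+bY, cX+dY).
-- Polynomials in X (Y-degree implicit) as coefficient functions ℕ → ℚ.

-- (pX + qY)^i : coefficient of X^j Y^(i-j) is C(i,j) p^j q^(i-j)
linPowF : ℚ → ℚ → ℕ → ℕ → ℚ
linPowF p q i j = if j ≤ᵇ i then ℕ→ℚ (i C j) * (p ^ j) * (q ^ (i ∸ j)) else 0ℚ

-- product of homogeneous polynomials (coefficients indexed by X-degree)
convF : (ℕ → ℚ) → (ℕ → ℚ) → ℕ → ℚ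
convF f g k = Σ≤ k (λ j → f j * g (k ∸ j))

_∣_ : ∀ {n} → V n → Mat → V n
_∣_ {n} P (mat a b c d) =
  tabulate (λ k → Σ≤ n (λ i →
    coef P i * convF (linPowF (ℤ→ℚ a) (ℤ→ℚ b) i) (linPowF (ℤ→ℚ c) (ℤ→ℚ d) (n ∸ i)) (toℕ k)))

IsCocycle : ∀ {n} → (Mat → V n) → Set
IsCocycle φ = ∀ g h → InΓ g → InΓ h → φ (g · h) ≡ (φ g ∣ h) ⊕ φ h

δ⁰ : ∀ {n} → V n → Mat → V n
δ⁰ v γ = (v ∣ γ) ⊖ v

-- The prescribed values of e⁰_{2k} at S and T, with n = 2k-2.

-- (n!/2) · [degree-n component of c(X)c(Y)]:
-- coefficient of X^i Y^(n-i) is (n!/2) c_i c_{n-i}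
e0S : (n : ℕ) → V n
e0S n = tabulate (λ i → (ℕ→ℚ (n !) * ((+ 1) / 2)) * (cCoeff (toℕ i) * cCoeff (n ∸ toℕ i)))

-- (n!/2) · [degree-n component of (c(X+Y) - c(X))/Y]:
-- the degree-(n+1) part of c(X+Y) - c(X) is c_{n+1} Σ_{j ≤ n} C(n+1,j) X^j Y^(n+1-j),
-- so after dividing by Y the coefficient of X^j Y^(n-j) is c_{n+1} C(n+1,j)
e0T : (n : ℕ) → V n
e0T n = tabulate (λ j → (ℕ→ℚ (n !) * ((+ 1) / 2)) * (cCoeff (suc n) * ℕ→ℚ (suc n C toℕ j)))

-- The pairing on V_n characterised by ⟨P,(aX+bY)^n⟩ = P(-b,a):
-- ⟨X^i Y^(n-i), X^(n-i) Y^i⟩ = (-1)^i / C(n,i), other monomial pairs 0.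

⟨_,_⟩ : ∀ {n} → V n → V n → ℚ
⟨_,_⟩ {n} P Q = Σ≤ n (λ i → ((- 1ℚ) ^ i) * inv (n C i) * coef P i * coef Q (n ∸ i))

⟦_,_⟧ : ∀ {n} → (Mat → V n) → (Mat → V n) → ℚ
⟦ P , Q ⟧ = ⟨ P Smat , (Q Smat ∣ Tmat) ⊖ (Q Smat ∣ Tinv) ⟩
          - ℕ→ℚ 2 * ⟨ P Tmat , Q Smat ⊕ (Q Smat ∣ Tmat) ⟩

{-# OPTIONS --safe #-}
module Submission where

-- The vector δ⁰Yⁿ(S) = Xⁿ - Yⁿ has binomial coefficients after translation by T and T⁻¹.
-- As c(x) is odd, the first term of {e⁰, δ⁰Yⁿ} becomes -n! Σᵢ cᵢ cₙ₋ᵢ and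
-- the second an explicit multiple of n! cₙ₊₁. The convolution is removed by the Riccati equation
-- x c′ + 2c = x/4 - x c², which follows from x G′ = G - x G - G² for G = x/(eˣ - 1), the reciprocal
-- of the power series (eˣ - 1)/x. What remains is 3 (n+1)! cₙ₊₁, and (n+2)! cₙ₊₁ = Bₙ₊₂ because
-- Bₘ/m! and the coefficients of G obey the same recursion.

open import Defs

-- Anonymous, so that the rational operations opened here are not in scope in the statement of
-- mainTheorem3, which uses ℕ's _*_.
module _ where
  open import Function using (_∘_)
  open import Data.Nat as ℕ using (ℕ; zero; suc; _∸_; _!; z≤n; s≤s; _≤ᵇ_)
  import Data.Nat.Properties as ℕₚ
  open ℕₚ using (_!≢0)
  open import Data.Nat.Combinatorics using (_C_; nCk≡n!/k![n-k]!; k![n∸k]!∣n!; nCn≡1; nCk≡nC[n∸k]; nC1≡n; nCk+nC[k+1]≡[n+1]C[k+1])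
  open import Data.Nat.DivMod using (m/n*n≡m)
  import Data.Integer as ℤ
  import Data.Integer.Properties as ℤₚ
  open import Data.Rational using (ℚ; 0ℚ; 1ℚ; _+_; _*_; _-_; -_; _/_; mkℚ)
  open import Data.Rational.Properties
  import Data.Nat.Coprimality as Coprime
  open import Data.List using (List; []; _∷_; _++_; applyUpTo; map; length)
  import Data.List.Properties as Listₚ
  open import Data.Fin using (toℕ)
  open import Data.Vec using (tabulate; zipWith; _∷_)
  open import Data.Bool using (true; if_then_else_)
  open import Data.Product using (∃; _×_; _,_)
  open import Data.Sum using (_⊎_; inj₁; inj₂)
  open import Relation.Binary.PropositionalEquality
  open import Data.Rational.Solver using (module +-*-Solver)
  open +-*-Solver using (solve; _:+_; _:*_; _:-_; :-_; _:=_; con)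
  open ≡-Reasoning

  ℕ→ℚ≡mkℚ : ∀ m → ℕ→ℚ m ≡ mkℚ (ℤ.+ m) 0 (Coprime.sym (Coprime.1-coprimeTo m))
  ℕ→ℚ≡mkℚ m = normalize-coprime (Coprime.sym (Coprime.1-coprimeTo m))

  ℕ→ℚ-+ : ∀ a b → ℕ→ℚ (a ℕ.+ b) ≡ ℕ→ℚ a + ℕ→ℚ b
  ℕ→ℚ-+ a b = begin
    ℤ.+ (a ℕ.+ b) / 1                          ≡⟨ cong (_/ 1) (ℤₚ.pos-+ a b) ⟩
    (ℤ.+ a ℤ.+ ℤ.+ b) / 1                      ≡⟨ cong (_/ 1) (cong₂ ℤ._+_ (ℤₚ.*-identityʳ (ℤ.+ a)) (ℤₚ.*-identityʳ (ℤ.+ b))) ⟨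
    (ℤ.+ a ℤ.* ℤ.+ 1 ℤ.+ ℤ.+ b ℤ.* ℤ.+ 1) / 1  ≡⟨ cong₂ _+_ (ℕ→ℚ≡mkℚ a) (ℕ→ℚ≡mkℚ b) ⟨
    ℕ→ℚ a + ℕ→ℚ b                              ∎

  ℕ→ℚ-* : ∀ a b → ℕ→ℚ (a ℕ.* b) ≡ ℕ→ℚ a * ℕ→ℚ b
  ℕ→ℚ-* a b = trans (cong (_/ 1) (ℤₚ.pos-* a b)) (sym (cong₂ _*_ (ℕ→ℚ≡mkℚ a) (ℕ→ℚ≡mkℚ b)))

  ℕ→ℚ-suc : ∀ a → ℕ→ℚ (suc a) ≡ 1ℚ + ℕ→ℚ a
  ℕ→ℚ-suc = ℕ→ℚ-+ 1

  inv-inverseˡ : ∀ m .{{_ : ℕ.NonZero m}} → inv m * ℕ→ℚ m ≡ 1ℚ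
  inv-inverseˡ (suc m) rewrite normalize-coprime (Coprime.1-coprimeTo (suc m)) | ℕ→ℚ≡mkℚ (suc m) =
    *-inverseˡ (mkℚ (ℤ.+ suc m) 0 (Coprime.sym (Coprime.1-coprimeTo (suc m))))

  *-cancelʳ-ℕ→ℚ : ∀ {x y} m .{{_ : ℕ.NonZero m}} → x * ℕ→ℚ m ≡ y * ℕ→ℚ m → x ≡ y
  *-cancelʳ-ℕ→ℚ {x} {y} m eq = begin
    x                  ≡⟨ unscale x ⟩
    x * ℕ→ℚ m * inv m  ≡⟨ cong (_* inv m) eq ⟩
    y * ℕ→ℚ m * inv m  ≡⟨ unscale y ⟨
    y                  ∎
    where
    unscale : ∀ z → z ≡ z * ℕ→ℚ m * inv m
    unscale z = begin
      z                        ≡⟨ *-identityʳ z ⟨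
      z * 1ℚ                   ≡⟨ cong (z *_) (inv-inverseˡ m) ⟨
      z * (inv m * ℕ→ℚ m)      ≡⟨ solve 3 (λ z i a → z :* (i :* a) := z :* a :* i) refl z (inv m) (ℕ→ℚ m) ⟩
      z * ℕ→ℚ m * inv m        ∎

  -[1+n]*x≡0⇒x≡0 : ∀ n x → - ℕ→ℚ (suc n) * x ≡ 0ℚ → x ≡ 0ℚ
  -[1+n]*x≡0⇒x≡0 n x eq = *-cancelʳ-ℕ→ℚ (suc n) (begin
    x * ℕ→ℚ (suc n)           ≡⟨ solve 2 (λ x a → x :* a := :- (:- a :* x)) refl x (ℕ→ℚ (suc n)) ⟩
    - (- ℕ→ℚ (suc n) * x)     ≡⟨ cong -_ eq ⟩
    0ℚ                        ≡⟨ *-zeroˡ (ℕ→ℚ (suc n)) ⟨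
    0ℚ * ℕ→ℚ (suc n)          ∎)

  nCk*[k!*[n-k]!]≡n! : ∀ n k → k ℕ.≤ n → (n C k) ℕ.* (k ! ℕ.* (n ∸ k) !) ≡ n !
  nCk*[k!*[n-k]!]≡n! n k k≤n = trans (cong (ℕ._* (k ! ℕ.* (n ∸ k) !)) (nCk≡n!/k![n-k]! k≤n))
    (m/n*n≡m {{ℕₚ._!*_!≢0 k (n ∸ k)}} (k![n∸k]!∣n! k≤n))

  nCk≢0 : ∀ n k → k ℕ.≤ n → ℕ.NonZero (n C k)
  nCk≢0 n k k≤n = ℕₚ.m*n≢0⇒m≢0 (n C k) {{subst ℕ.NonZero (sym (nCk*[k!*[n-k]!]≡n! n k k≤n)) (n !≢0)}}

  inv[nCi]*nCi≡1 : ∀ n i → i ℕ.≤ n → inv (n C i) * ℕ→ℚ (n C i) ≡ 1ℚ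
  inv[nCi]*nCi≡1 n i i≤n = inv-inverseˡ (n C i) {{nCk≢0 n i i≤n}}

  [1+n]Cn≡1+n : ∀ n → suc n C n ≡ suc n
  [1+n]Cn≡1+n n = trans (nCk≡nC[n∸k] (ℕₚ.n≤1+n n)) (trans (cong (suc n C_) (ℕₚ.m+n∸n≡m 1 n)) (nC1≡n (suc n)))

  [1+k]*inv[[1+k]!]≡inv[k!] : ∀ k → ℕ→ℚ (suc k) * inv (suc k !) ≡ inv (k !)
  [1+k]*inv[[1+k]!]≡inv[k!] k = *-cancelʳ-ℕ→ℚ (k !) {{k !≢0}} (begin
    ℕ→ℚ (suc k) * inv (suc k !) * ℕ→ℚ (k !)   ≡⟨ solve 3 (λ a b c → a :* b :* c := b :* (a :* c)) refl (ℕ→ℚ (suc k)) (inv (suc k !)) (ℕ→ℚ (k !)) ⟩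
    inv (suc k !) * (ℕ→ℚ (suc k) * ℕ→ℚ (k !)) ≡⟨ cong (inv (suc k !) *_) (ℕ→ℚ-* (suc k) (k !)) ⟨
    inv (suc k !) * ℕ→ℚ (suc k !)             ≡⟨ inv-inverseˡ (suc k !) {{suc k !≢0}} ⟩
    1ℚ                                        ≡⟨ inv-inverseˡ (k !) {{k !≢0}} ⟨
    inv (k !) * ℕ→ℚ (k !)                     ∎)

  [1+m]Cj*j!/[1+m]≡m!/[1+m-j]! : ∀ m j → j ℕ.≤ suc m →
    inv (suc m) * ℕ→ℚ (suc m C j) * ℕ→ℚ (j !) ≡ ℕ→ℚ (m !) * inv ((suc m ∸ j) !)
  [1+m]Cj*j!/[1+m]≡m!/[1+m-j]! m j j≤1+m = *-cancelʳ-ℕ→ℚ (r !) {{r !≢0}} (begin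
    inv (suc m) * ℕ→ℚ (suc m C j) * ℕ→ℚ (j !) * ℕ→ℚ (r !)
      ≡⟨ solve 4 (λ i c a b → i :* c :* a :* b := i :* (c :* (a :* b))) refl (inv (suc m)) (ℕ→ℚ (suc m C j)) (ℕ→ℚ (j !)) (ℕ→ℚ (r !)) ⟩
    inv (suc m) * (ℕ→ℚ (suc m C j) * (ℕ→ℚ (j !) * ℕ→ℚ (r !)))
      ≡⟨ cong (inv (suc m) *_) (trans (ℕ→ℚ-* (suc m C j) _) (cong (ℕ→ℚ (suc m C j) *_) (ℕ→ℚ-* (j !) (r !)))) ⟨
    inv (suc m) * ℕ→ℚ ((suc m C j) ℕ.* (j ! ℕ.* r !))
      ≡⟨ cong (λ x → inv (suc m) * ℕ→ℚ x) (nCk*[k!*[n-k]!]≡n! (suc m) j j≤1+m) ⟩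
    inv (suc m) * ℕ→ℚ (suc m ℕ.* m !)
      ≡⟨ cong (inv (suc m) *_) (ℕ→ℚ-* (suc m) (m !)) ⟩
    inv (suc m) * (ℕ→ℚ (suc m) * ℕ→ℚ (m !))
      ≡⟨ solve 3 (λ i a b → i :* (a :* b) := (i :* a) :* b) refl (inv (suc m)) (ℕ→ℚ (suc m)) (ℕ→ℚ (m !)) ⟩
    inv (suc m) * ℕ→ℚ (suc m) * ℕ→ℚ (m !)
      ≡⟨ cong (_* ℕ→ℚ (m !)) (inv-inverseˡ (suc m)) ⟩
    1ℚ * ℕ→ℚ (m !)
      ≡⟨ cong (_* ℕ→ℚ (m !)) (inv-inverseˡ (r !) {{r !≢0}}) ⟨
    inv (r !) * ℕ→ℚ (r !) * ℕ→ℚ (m !)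
      ≡⟨ solve 3 (λ i a b → i :* a :* b := b :* i :* a) refl (inv (r !)) (ℕ→ℚ (r !)) (ℕ→ℚ (m !)) ⟩
    ℕ→ℚ (m !) * inv (r !) * ℕ→ℚ (r !) ∎)
    where r = suc m ∸ j

  ^-+ : ∀ q a b → q ^ (a ℕ.+ b) ≡ q ^ a * q ^ b
  ^-+ q zero    b = sym (*-identityˡ _)
  ^-+ q (suc a) b = trans (cong (q *_) (^-+ q a b)) (sym (*-assoc q (q ^ a) (q ^ b)))

  1^k≡1 : ∀ k → 1ℚ ^ k ≡ 1ℚ
  1^k≡1 zero    = refl
  1^k≡1 (suc k) = trans (*-identityˡ _) (1^k≡1 k)

  [-1]^i*[-1]^i≡1 : ∀ i → (- 1ℚ) ^ i * (- 1ℚ) ^ i ≡ 1ℚ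
  [-1]^i*[-1]^i≡1 zero    = refl
  [-1]^i*[-1]^i≡1 (suc i) =
    trans (solve 1 (λ s → (:- con 1ℚ :* s) :* (:- con 1ℚ :* s) := s :* s) refl ((- 1ℚ) ^ i)) ([-1]^i*[-1]^i≡1 i)

  [-1]^[2*s]≡1 : ∀ s → (- 1ℚ) ^ (2 ℕ.* s) ≡ 1ℚ
  [-1]^[2*s]≡1 s = begin
    (- 1ℚ) ^ (s ℕ.+ (s ℕ.+ 0))       ≡⟨ cong (λ k → (- 1ℚ) ^ (s ℕ.+ k)) (ℕₚ.+-identityʳ s) ⟩
    (- 1ℚ) ^ (s ℕ.+ s)               ≡⟨ ^-+ (- 1ℚ) s s ⟩
    (- 1ℚ) ^ s * (- 1ℚ) ^ s          ≡⟨ [-1]^i*[-1]^i≡1 s ⟩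
    1ℚ                               ∎

  even-or-odd : ∀ j → ∃ λ s → j ≡ 2 ℕ.* s ⊎ j ≡ suc (2 ℕ.* s)
  even-or-odd zero = 0 , inj₁ refl
  even-or-odd (suc j) with even-or-odd j
  ... | s , inj₁ j≡2s  = s , inj₂ (cong suc j≡2s)
  ... | s , inj₂ j≡1+2s = suc s , inj₁ (trans (cong suc j≡1+2s) (sym (ℕₚ.*-suc 2 s)))

  -- In Σ_{j ≤ 2t+1} c_j c_{2t+1-j} every term has a factor of even index ≤ 2t.
  even-factor-of-odd-sum : ∀ t j → j ℕ.≤ suc (2 ℕ.* t) → ∃ λ s → s ℕ.≤ t × (j ≡ 2 ℕ.* s ⊎ suc (2 ℕ.* t) ∸ j ≡ 2 ℕ.* s)
  even-factor-of-odd-sum t j j≤ with even-or-odd j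
  ... | s , inj₁ refl = s , ℕₚ.≤-pred (ℕₚ.*-cancelˡ-< 2 s (suc t) 2s<2[1+t]) , inj₁ refl
    where
    2s<2[1+t] : 2 ℕ.* s ℕ.< 2 ℕ.* suc t
    2s<2[1+t] = subst (2 ℕ.* s ℕ.<_) (sym (ℕₚ.*-suc 2 t)) (s≤s j≤)
  ... | s , inj₂ refl = t ∸ s , ℕₚ.m∸n≤m t s , inj₂ (sym (ℕₚ.*-distribˡ-∸ 2 t s))

  Σ< : ℕ → (ℕ → ℚ) → ℚ
  Σ< zero    f = 0ℚ
  Σ< (suc n) f = f 0 + Σ< n (f ∘ suc)

  sumℚ-map-applyUpTo : ∀ n (f : ℕ → ℚ) g → sumℚ (map f (applyUpTo g n)) ≡ Σ< n (f ∘ g)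
  sumℚ-map-applyUpTo zero    f g = refl
  sumℚ-map-applyUpTo (suc n) f g = cong (f (g 0) +_) (sumℚ-map-applyUpTo n f (g ∘ suc))

  Σ≤≡Σ< : ∀ m f → Σ≤ m f ≡ Σ< (suc m) f
  Σ≤≡Σ< m f = sumℚ-map-applyUpTo (suc m) f (λ i → i)

  Σ<-cong : ∀ n {f g : ℕ → ℚ} → (∀ i → i ℕ.< n → f i ≡ g i) → Σ< n f ≡ Σ< n g
  Σ<-cong zero    eq = refl
  Σ<-cong (suc n) eq = cong₂ _+_ (eq 0 (s≤s z≤n)) (Σ<-cong n (λ i i<n → eq (suc i) (s≤s i<n)))

  Σ<-zero : ∀ n → Σ< n (λ _ → 0ℚ) ≡ 0ℚ
  Σ<-zero zero    = refl
  Σ<-zero (suc n) = trans (+-identityˡ _) (Σ<-zero n)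

  Σ<-vanishing : ∀ n {f : ℕ → ℚ} → (∀ i → i ℕ.< n → f i ≡ 0ℚ) → Σ< n f ≡ 0ℚ
  Σ<-vanishing n eq = trans (Σ<-cong n eq) (Σ<-zero n)

  Σ<-+ : ∀ n (f g : ℕ → ℚ) → Σ< n (λ i → f i + g i) ≡ Σ< n f + Σ< n g
  Σ<-+ zero    f g = refl
  Σ<-+ (suc n) f g = trans (cong (f 0 + g 0 +_) (Σ<-+ n (f ∘ suc) (g ∘ suc)))
    (solve 4 (λ a b c d → (a :+ b) :+ (c :+ d) := (a :+ c) :+ (b :+ d)) refl (f 0) (g 0) _ _)

  Σ<-*ˡ : ∀ n c (f : ℕ → ℚ) → Σ< n (λ i → c * f i) ≡ c * Σ< n f
  Σ<-*ˡ zero    c f = sym (*-zeroʳ c)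
  Σ<-*ˡ (suc n) c f = trans (cong (c * f 0 +_) (Σ<-*ˡ n c (f ∘ suc))) (sym (*-distribˡ-+ c (f 0) _))

  Σ<-neg : ∀ n (f : ℕ → ℚ) → Σ< n (λ i → - f i) ≡ - Σ< n f
  Σ<-neg zero    f = refl
  Σ<-neg (suc n) f = trans (cong (- f 0 +_) (Σ<-neg n (f ∘ suc)))
    (solve 2 (λ a b → (:- a) :+ (:- b) := :- (a :+ b)) refl (f 0) _)

  Σ<-- : ∀ n (f g : ℕ → ℚ) → Σ< n (λ i → f i - g i) ≡ Σ< n f - Σ< n g
  Σ<-- n f g = trans (Σ<-+ n f (λ i → - g i)) (cong (Σ< n f +_) (Σ<-neg n g))

  Σ<-snoc : ∀ n (f : ℕ → ℚ) → Σ< (suc n) f ≡ Σ< n f + f n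
  Σ<-snoc zero    f = trans (+-identityʳ (f 0)) (sym (+-identityˡ (f 0)))
  Σ<-snoc (suc n) f = trans (cong (f 0 +_) (Σ<-snoc n (f ∘ suc))) (sym (+-assoc (f 0) _ _))

  Σ<-reverse : ∀ m (f : ℕ → ℚ) → Σ< (suc m) f ≡ Σ< (suc m) (λ j → f (m ∸ j))
  Σ<-reverse zero    f = refl
  Σ<-reverse (suc m) f = begin
    f 0 + Σ< (suc m) (f ∘ suc)                        ≡⟨ cong (f 0 +_) (Σ<-reverse m (f ∘ suc)) ⟩
    f 0 + Σ< (suc m) (λ j → f (suc (m ∸ j)))          ≡⟨ +-comm (f 0) _ ⟩
    Σ< (suc m) (λ j → f (suc (m ∸ j))) + f 0          ≡⟨ cong₂ _+_ (Σ<-cong (suc m) (λ j j≤m → cong f (sym (ℕₚ.+-∸-assoc 1 (ℕₚ.≤-pred j≤m)))))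
                                                                     (cong f (sym (ℕₚ.n∸n≡0 m))) ⟩
    Σ< (suc m) (λ j → f (suc m ∸ j)) + f (suc m ∸ suc m)  ≡⟨ Σ<-snoc (suc m) (λ j → f (suc m ∸ j)) ⟨
    Σ< (suc (suc m)) (λ j → f (suc m ∸ j))            ∎

  Σ[-1]^j*[1+N]Cj≡[-1]^m*NCm : ∀ N m → Σ< (suc m) (λ j → (- 1ℚ) ^ j * ℕ→ℚ (suc N C j)) ≡ (- 1ℚ) ^ m * ℕ→ℚ (N C m)
  Σ[-1]^j*[1+N]Cj≡[-1]^m*NCm N zero    = refl
  Σ[-1]^j*[1+N]Cj≡[-1]^m*NCm N (suc m) = begin
    Σ< (2 ℕ.+ m) (λ j → (- 1ℚ) ^ j * ℕ→ℚ (suc N C j))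
      ≡⟨ Σ<-snoc (suc m) (λ j → (- 1ℚ) ^ j * ℕ→ℚ (suc N C j)) ⟩
    Σ< (suc m) (λ j → (- 1ℚ) ^ j * ℕ→ℚ (suc N C j)) + (- 1ℚ) ^ suc m * ℕ→ℚ (suc N C suc m)
      ≡⟨ cong₂ (λ x y → x + (- 1ℚ) ^ suc m * y) (Σ[-1]^j*[1+N]Cj≡[-1]^m*NCm N m)
               (trans (cong ℕ→ℚ (sym (nCk+nC[k+1]≡[n+1]C[k+1] N m))) (ℕ→ℚ-+ (N C m) (N C suc m))) ⟩
    s * ℕ→ℚ (N C m) + - 1ℚ * s * (ℕ→ℚ (N C m) + ℕ→ℚ (N C suc m))
      ≡⟨ solve 3 (λ s x y → s :* x :+ (:- con 1ℚ) :* s :* (x :+ y) := (:- con 1ℚ) :* s :* y) refl s (ℕ→ℚ (N C m)) (ℕ→ℚ (N C suc m)) ⟩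
    - 1ℚ * s * ℕ→ℚ (N C suc m) ∎
    where s = (- 1ℚ) ^ m

  -- Formal power series

  Series : Set
  Series = ℕ → ℚ

  δ : Series
  δ zero    = 1ℚ
  δ (suc _) = 0ℚ

  δ-∸-< : ∀ {i n} → i ℕ.< n → δ (n ∸ i) ≡ 0ℚ
  δ-∸-< {zero}  {suc n} _         = refl
  δ-∸-< {suc i} {suc n} (s≤s i<n) = δ-∸-< i<n

  Σ<-δ-first : ∀ n (f : ℕ → ℚ) → Σ< (suc n) (λ i → δ i * f i) ≡ f 0
  Σ<-δ-first n f = begin
    1ℚ * f 0 + Σ< n (λ i → 0ℚ * f (suc i))  ≡⟨ cong₂ _+_ (*-identityˡ (f 0)) (Σ<-vanishing n (λ i _ → *-zeroˡ (f (suc i)))) ⟩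
    f 0 + 0ℚ                                ≡⟨ +-identityʳ (f 0) ⟩
    f 0                                     ∎

  Σ<-δ-last : ∀ n (f : ℕ → ℚ) → Σ< (suc n) (λ i → δ (n ∸ i) * f i) ≡ f n
  Σ<-δ-last n f = begin
    Σ< (suc n) (λ i → δ (n ∸ i) * f i)           ≡⟨ Σ<-snoc n (λ i → δ (n ∸ i) * f i) ⟩
    Σ< n (λ i → δ (n ∸ i) * f i) + δ (n ∸ n) * f n
      ≡⟨ cong₂ _+_ (Σ<-vanishing n (λ i i<n → trans (cong (_* f i) (δ-∸-< i<n)) (*-zeroˡ (f i))))
                   (cong (λ k → δ k * f n) (ℕₚ.n∸n≡0 n)) ⟩
    0ℚ + 1ℚ * f n                                ≡⟨ trans (+-identityˡ _) (*-identityˡ (f n)) ⟩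
    f n                                          ∎

  0^k≡δk : ∀ k → 0ℚ ^ k ≡ δ k
  0^k≡δk zero    = refl
  0^k≡δk (suc k) = *-zeroˡ (0ℚ ^ k)

  infixl 7 _⋆_
  infixl 6 _+ₛ_ _-ₛ_
  infixr 8 _•_

  _⋆_ : Series → Series → Series
  (f ⋆ g) m = Σ< (suc m) (λ j → f j * g (m ∸ j))

  _+ₛ_ _-ₛ_ : Series → Series → Series
  (f +ₛ g) i = f i + g i
  (f -ₛ g) i = f i - g i

  _•_ : ℚ → Series → Series
  (c • f) i = c * f i

  -- multiplication by x
  shift : Series → Series
  shift f zero    = 0ℚ
  shift f (suc m) = f m

  tail : Series → Series
  tail f = f ∘ suc

  -- the Euler operator x d/dx
  θ : Series → Series
  θ f m = ℕ→ℚ m * f m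

  ⋆-cong : ∀ {f f′ g g′} → f ≗ f′ → g ≗ g′ → f ⋆ g ≗ f′ ⋆ g′
  ⋆-cong f≗f′ g≗g′ m = Σ<-cong (suc m) (λ j _ → cong₂ _*_ (f≗f′ j) (g≗g′ (m ∸ j)))

  ⋆-comm : ∀ f g → f ⋆ g ≗ g ⋆ f
  ⋆-comm f g m = trans (Σ<-reverse m (λ j → f j * g (m ∸ j)))
    (Σ<-cong (suc m) (λ j j≤m → trans (cong (λ k → f (m ∸ j) * g k) (ℕₚ.m∸[m∸n]≡n (ℕₚ.≤-pred j≤m))) (*-comm (f (m ∸ j)) (g j))))

  ⋆-distribʳ-+ : ∀ f h g → (f +ₛ h) ⋆ g ≗ f ⋆ g +ₛ h ⋆ g
  ⋆-distribʳ-+ f h g m = trans (Σ<-cong (suc m) (λ j _ → *-distribʳ-+ (g (m ∸ j)) (f j) (h j)))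
    (Σ<-+ (suc m) (λ j → f j * g (m ∸ j)) (λ j → h j * g (m ∸ j)))

  ⋆-distribʳ-- : ∀ f h g → (f -ₛ h) ⋆ g ≗ f ⋆ g -ₛ h ⋆ g
  ⋆-distribʳ-- f h g m = trans (Σ<-cong (suc m) (λ j _ → solve 3 (λ a b c → (a :- b) :* c := a :* c :- b :* c) refl (f j) (h j) (g (m ∸ j))))
    (Σ<-- (suc m) (λ j → f j * g (m ∸ j)) (λ j → h j * g (m ∸ j)))

  •-⋆ : ∀ c f g → (c • f) ⋆ g ≗ c • (f ⋆ g)
  •-⋆ c f g m = trans (Σ<-cong (suc m) (λ j _ → *-assoc c (f j) (g (m ∸ j)))) (Σ<-*ˡ (suc m) c (λ j → f j * g (m ∸ j)))

  ⋆-distribˡ-+ : ∀ f g h → f ⋆ (g +ₛ h) ≗ f ⋆ g +ₛ f ⋆ h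
  ⋆-distribˡ-+ f g h m = trans (⋆-comm f (g +ₛ h) m)
    (trans (⋆-distribʳ-+ g h f m) (cong₂ _+_ (⋆-comm g f m) (⋆-comm h f m)))

  ⋆-distribˡ-- : ∀ f g h → f ⋆ (g -ₛ h) ≗ f ⋆ g -ₛ f ⋆ h
  ⋆-distribˡ-- f g h m = trans (⋆-comm f (g -ₛ h) m)
    (trans (⋆-distribʳ-- g h f m) (cong₂ _-_ (⋆-comm g f m) (⋆-comm h f m)))

  ⋆-• : ∀ c f g → f ⋆ (c • g) ≗ c • (f ⋆ g)
  ⋆-• c f g m = trans (⋆-comm f (c • g) m) (trans (•-⋆ c g f m) (cong (c *_) (⋆-comm g f m)))

  ⋆-identityˡ : ∀ f → δ ⋆ f ≗ f
  ⋆-identityˡ f m = Σ<-δ-first m (λ j → f (m ∸ j))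

  ⋆-identityʳ : ∀ f → f ⋆ δ ≗ f
  ⋆-identityʳ f m = trans (⋆-comm f δ m) (⋆-identityˡ f m)

  shift-cong : ∀ {f g} → f ≗ g → shift f ≗ shift g
  shift-cong f≗g zero    = refl
  shift-cong f≗g (suc m) = f≗g m

  shift-⋆ : ∀ f g → shift f ⋆ g ≗ shift (f ⋆ g)
  shift-⋆ f g zero    = trans (+-identityʳ _) (*-zeroˡ (g 0))
  shift-⋆ f g (suc m) = trans (cong (_+ (f ⋆ g) m) (*-zeroˡ (g (suc m)))) (+-identityˡ _)

  ⋆-shift-δ : ∀ f → f ⋆ shift δ ≗ shift f
  ⋆-shift-δ f zero    = trans (⋆-comm f (shift δ) 0) (shift-⋆ δ f 0)
  ⋆-shift-δ f (suc m) = trans (⋆-comm f (shift δ) (suc m)) (trans (shift-⋆ δ f (suc m)) (⋆-identityˡ f m))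

  ⋆-unconsˡ : ∀ f g m → (f ⋆ g) m ≡ f 0 * g m + shift (tail f ⋆ g) m
  ⋆-unconsˡ f g zero    = refl
  ⋆-unconsˡ f g (suc m) = refl

  ⋆-assoc : ∀ f g h → (f ⋆ g) ⋆ h ≗ f ⋆ (g ⋆ h)
  ⋆-assoc f g h m = begin
    ((f ⋆ g) ⋆ h) m                                  ≡⟨ ⋆-cong {g = h} (⋆-unconsˡ f g) (λ _ → refl) m ⟩
    ((f 0 • g +ₛ shift (tail f ⋆ g)) ⋆ h) m          ≡⟨ ⋆-distribʳ-+ (f 0 • g) (shift (tail f ⋆ g)) h m ⟩
    ((f 0 • g) ⋆ h) m + (shift (tail f ⋆ g) ⋆ h) m   ≡⟨ cong₂ _+_ (•-⋆ (f 0) g h m) (shift-⋆ (tail f ⋆ g) h m) ⟩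
    f 0 * (g ⋆ h) m + shift ((tail f ⋆ g) ⋆ h) m     ≡⟨ cong (f 0 * (g ⋆ h) m +_) (shift-assoc m) ⟩
    f 0 * (g ⋆ h) m + shift (tail f ⋆ (g ⋆ h)) m     ≡⟨ ⋆-unconsˡ f (g ⋆ h) m ⟨
    (f ⋆ (g ⋆ h)) m                                  ∎
    where
    shift-assoc : shift ((tail f ⋆ g) ⋆ h) ≗ shift (tail f ⋆ (g ⋆ h))
    shift-assoc zero    = refl
    shift-assoc (suc m) = ⋆-assoc (tail f) g h m

  θ-δ : ∀ m → θ δ m ≡ 0ℚ
  θ-δ zero    = refl
  θ-δ (suc m) = *-zeroʳ (ℕ→ℚ (suc m))

  θ-⋆ : ∀ f g → θ (f ⋆ g) ≗ θ f ⋆ g +ₛ f ⋆ θ g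
  θ-⋆ f g m = begin
    ℕ→ℚ m * Σ< (suc m) (λ j → f j * g (m ∸ j))       ≡⟨ Σ<-*ˡ (suc m) (ℕ→ℚ m) (λ j → f j * g (m ∸ j)) ⟨
    Σ< (suc m) (λ j → ℕ→ℚ m * (f j * g (m ∸ j)))     ≡⟨ Σ<-cong (suc m) (λ j j≤m → leibniz j (ℕₚ.≤-pred j≤m)) ⟩
    Σ< (suc m) (λ j → θ f j * g (m ∸ j) + f j * θ g (m ∸ j))
                                                      ≡⟨ Σ<-+ (suc m) (λ j → θ f j * g (m ∸ j)) (λ j → f j * θ g (m ∸ j)) ⟩
    (θ f ⋆ g) m + (f ⋆ θ g) m                         ∎
    where
    leibniz : ∀ j → j ℕ.≤ m → ℕ→ℚ m * (f j * g (m ∸ j)) ≡ θ f j * g (m ∸ j) + f j * θ g (m ∸ j)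
    leibniz j j≤m = begin
      ℕ→ℚ m * (f j * g (m ∸ j))                     ≡⟨ cong (λ k → ℕ→ℚ k * (f j * g (m ∸ j))) (ℕₚ.m+[n∸m]≡n j≤m) ⟨
      ℕ→ℚ (j ℕ.+ (m ∸ j)) * (f j * g (m ∸ j))       ≡⟨ cong (_* (f j * g (m ∸ j))) (ℕ→ℚ-+ j (m ∸ j)) ⟩
      (ℕ→ℚ j + ℕ→ℚ (m ∸ j)) * (f j * g (m ∸ j))     ≡⟨ solve 4 (λ a b x y → (a :+ b) :* (x :* y) := a :* x :* y :+ x :* (b :* y)) refl
                                                          (ℕ→ℚ j) (ℕ→ℚ (m ∸ j)) (f j) (g (m ∸ j)) ⟩
      θ f j * g (m ∸ j) + f j * θ g (m ∸ j)         ∎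

  -- The series x/(eˣ - 1)

  at-++-< : ∀ xs (y : ℚ) i → i ℕ.< length xs → at (xs ++ y ∷ []) i ≡ at xs i
  at-++-< (x ∷ xs) y zero    _         = refl
  at-++-< (x ∷ xs) y (suc i) (s≤s i<n) = at-++-< xs y i i<n

  at-++-length : ∀ xs (y : ℚ) → at (xs ++ y ∷ []) (length xs) ≡ y
  at-++-length []       y = refl
  at-++-length (x ∷ xs) y = at-++-length xs y

  -- The recursion pattern shared by bernoulliList and invEList.
  module Growing (L : ℕ → List ℚ) (L-zero : length (L 0) ≡ 1)
                 (next : ℕ → ℚ) (L-suc : ∀ m → L (suc m) ≡ L m ++ next m ∷ []) where

    length-L : ∀ m → length (L m) ≡ suc m
    length-L zero    = L-zero
    length-L (suc m) rewrite L-suc m =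
      trans (Listₚ.length-++ (L m)) (trans (cong (ℕ._+ 1) (length-L m)) (ℕₚ.+-comm (suc m) 1))

    at-L-stable : ∀ m i → i ℕ.≤ m → at (L m) i ≡ at (L i) i
    at-L-stable zero    .zero z≤n = refl
    at-L-stable (suc m) i i≤1+m with ℕₚ.m≤n⇒m<n∨m≡n i≤1+m
    ... | inj₂ refl      = refl
    ... | inj₁ (s≤s i≤m) rewrite L-suc m =
      trans (at-++-< (L m) (next m) i (subst (i ℕ.<_) (sym (length-L m)) (s≤s i≤m))) (at-L-stable m i i≤m)

    at-L-suc : ∀ m → at (L (suc m)) (suc m) ≡ next m
    at-L-suc m rewrite L-suc m = trans (cong (at (L m ++ next m ∷ [])) (sym (length-L m))) (at-++-length (L m) (next m))

  -- Taylor coefficients of (eˣ - 1)/x; invE is its reciprocal series.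
  E : Series
  E j = inv (suc j !)

  invE-suc : ∀ m → invE (suc m) ≡ - Σ< (suc m) (λ i → invE (m ∸ i) * E (suc i))
  invE-suc m = trans (G.at-L-suc m) (cong -_ (trans (Σ≤≡Σ< m (λ i → at (invEList m) (m ∸ i) * E (suc i)))
    (Σ<-cong (suc m) (λ i _ → cong (_* E (suc i)) (G.at-L-stable m (m ∸ i) (ℕₚ.m∸n≤m m i))))))
    where module G = Growing invEList refl _ (λ _ → refl)

  E⋆invE : E ⋆ invE ≗ δ
  E⋆invE zero    = refl
  E⋆invE (suc m) = begin
    E 0 * invE (suc m) + Σ< (suc m) (λ j → E (suc j) * invE (m ∸ j))
      ≡⟨ cong₂ (λ x y → E 0 * x + y) (invE-suc m) (Σ<-cong (suc m) (λ j _ → *-comm (E (suc j)) (invE (m ∸ j)))) ⟩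
    1ℚ * (- s) + s
      ≡⟨ solve 1 (λ s → con 1ℚ :* (:- s) :+ s := con 0ℚ) refl s ⟩
    0ℚ ∎
    where s = Σ< (suc m) (λ i → invE (m ∸ i) * E (suc i))

  -- x E′ = eˣ - E
  θ-E : θ E ≗ shift E +ₛ δ -ₛ E
  θ-E zero    = refl
  θ-E (suc m) = begin
    ℕ→ℚ (suc m) * e                     ≡⟨ solve 2 (λ a e → a :* e := (con 1ℚ :+ a) :* e :+ con 0ℚ :- e) refl (ℕ→ℚ (suc m)) e ⟩
    (1ℚ + ℕ→ℚ (suc m)) * e + 0ℚ - e     ≡⟨ cong (λ a → a * e + 0ℚ - e) (ℕ→ℚ-suc (suc m)) ⟨
    ℕ→ℚ (suc (suc m)) * e + 0ℚ - e      ≡⟨ cong (λ a → a + 0ℚ - e) ([1+k]*inv[[1+k]!]≡inv[k!] (suc m)) ⟩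
    E m + 0ℚ - e                        ∎
    where e = E (suc m)

  E⋆θinvE : E ⋆ θ invE ≗ δ -ₛ shift δ -ₛ invE
  E⋆θinvE m = begin
    (E ⋆ θ invE) m                                    ≡⟨ solve 2 (λ a b → b := (a :+ b) :- a) refl ((θ E ⋆ invE) m) ((E ⋆ θ invE) m) ⟩
    (θ E ⋆ invE) m + (E ⋆ θ invE) m - (θ E ⋆ invE) m  ≡⟨ cong₂ _-_ (trans (sym (θ-⋆ E invE m)) θ[E⋆invE]≡0) θE⋆invE ⟩
    0ℚ - (shift δ m + invE m - δ m)                   ≡⟨ solve 3 (λ a b c → con 0ℚ :- (a :+ b :- c) := c :- a :- b) refl (shift δ m) (invE m) (δ m) ⟩
    δ m - shift δ m - invE m                          ∎
    where
    θ[E⋆invE]≡0 : θ (E ⋆ invE) m ≡ 0ℚ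
    θ[E⋆invE]≡0 = trans (cong (ℕ→ℚ m *_) (E⋆invE m)) (θ-δ m)
    θE⋆invE : (θ E ⋆ invE) m ≡ shift δ m + invE m - δ m
    θE⋆invE = begin
      (θ E ⋆ invE) m                                              ≡⟨ ⋆-cong {g = invE} θ-E (λ _ → refl) m ⟩
      ((shift E +ₛ δ -ₛ E) ⋆ invE) m                              ≡⟨ ⋆-distribʳ-- (shift E +ₛ δ) E invE m ⟩
      ((shift E +ₛ δ) ⋆ invE) m - (E ⋆ invE) m                    ≡⟨ cong (_- (E ⋆ invE) m) (⋆-distribʳ-+ (shift E) δ invE m) ⟩
      (shift E ⋆ invE) m + (δ ⋆ invE) m - (E ⋆ invE) m
        ≡⟨ cong₂ (λ x y → x + y - (E ⋆ invE) m) (trans (shift-⋆ E invE m) (shift-cong E⋆invE m)) (⋆-identityˡ invE m) ⟩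
      shift δ m + invE m - (E ⋆ invE) m                           ≡⟨ cong (λ x → shift δ m + invE m - x) (E⋆invE m) ⟩
      shift δ m + invE m - δ m                                    ∎

  -- The Riccati equation x G′ = G - x G - G² for G = x/(eˣ - 1).
  θ-invE : θ invE ≗ invE -ₛ shift invE -ₛ invE ⋆ invE
  θ-invE m = begin
    θ invE m                                  ≡⟨ ⋆-identityˡ (θ invE) m ⟨
    (δ ⋆ θ invE) m                            ≡⟨ ⋆-cong {g = θ invE} (λ i → trans (sym (E⋆invE i)) (⋆-comm E invE i)) (λ _ → refl) m ⟩
    ((invE ⋆ E) ⋆ θ invE) m                   ≡⟨ ⋆-assoc invE E (θ invE) m ⟩
    (invE ⋆ (E ⋆ θ invE)) m                   ≡⟨ ⋆-cong {f = invE} (λ _ → refl) E⋆θinvE m ⟩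
    (invE ⋆ (δ -ₛ shift δ -ₛ invE)) m         ≡⟨ ⋆-distribˡ-- invE (δ -ₛ shift δ) invE m ⟩
    (invE ⋆ (δ -ₛ shift δ)) m - (invE ⋆ invE) m
      ≡⟨ cong (_- (invE ⋆ invE) m) (⋆-distribˡ-- invE δ (shift δ) m) ⟩
    (invE ⋆ δ) m - (invE ⋆ shift δ) m - (invE ⋆ invE) m
      ≡⟨ cong₂ (λ x y → x - y - (invE ⋆ invE) m) (⋆-identityʳ invE m) (⋆-shift-δ invE m) ⟩
    invE m - shift invE m - (invE ⋆ invE) m   ∎

  -- The function c(x) = 1/(eˣ - 1) + 1/2 - 1/x

  ½ : ℚ
  ½ = ℤ.+ 1 / 2

  cCoeff≗tail-invE+½δ : cCoeff ≗ tail invE +ₛ ½ • δ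
  cCoeff≗tail-invE+½δ zero    = refl
  cCoeff≗tail-invE+½δ (suc i) = sym (+-identityʳ (invE (suc (suc i))))

  invE⋆invE-uncons : ∀ n → (invE ⋆ invE) (2 ℕ.+ n) ≡ invE (2 ℕ.+ n) + invE (2 ℕ.+ n) + (tail invE ⋆ tail invE) n
  invE⋆invE-uncons n = begin
    1ℚ * g + (tail invE ⋆ invE) (suc n)    ≡⟨ cong (1ℚ * g +_) (⋆-comm (tail invE) invE (suc n)) ⟩
    1ℚ * g + (1ℚ * g + (tail invE ⋆ tail invE) n)
      ≡⟨ solve 2 (λ g t → con 1ℚ :* g :+ (con 1ℚ :* g :+ t) := g :+ g :+ t) refl g ((tail invE ⋆ tail invE) n) ⟩
    g + g + (tail invE ⋆ tail invE) n      ∎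
    where g = invE (2 ℕ.+ n)

  cCoeff⋆cCoeff : ∀ m → (cCoeff ⋆ cCoeff) (suc m) ≡ (tail invE ⋆ tail invE) (suc m) + invE (2 ℕ.+ m)
  cCoeff⋆cCoeff n = begin
    (cCoeff ⋆ cCoeff) m                          ≡⟨ ⋆-cong cCoeff≗tail-invE+½δ cCoeff≗tail-invE+½δ m ⟩
    ((g +ₛ ½ • δ) ⋆ h) m                         ≡⟨ ⋆-distribʳ-+ g (½ • δ) h m ⟩
    (g ⋆ h) m + ((½ • δ) ⋆ h) m                  ≡⟨ cong₂ _+_ (⋆-distribˡ-+ g g (½ • δ) m) (trans (•-⋆ ½ δ h m) (cong (½ *_) (⋆-identityˡ h m))) ⟩
    (g ⋆ g) m + (g ⋆ (½ • δ)) m + ½ * (g m + ½ * 0ℚ)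
      ≡⟨ cong (λ x → (g ⋆ g) m + x + ½ * (g m + ½ * 0ℚ)) (trans (⋆-• ½ g δ m) (cong (½ *_) (⋆-identityʳ g m))) ⟩
    (g ⋆ g) m + ½ * g m + ½ * (g m + ½ * 0ℚ)
      ≡⟨ solve 2 (λ a b → a :+ con ½ :* b :+ con ½ :* (b :+ con ½ :* con 0ℚ) := a :+ b) refl ((g ⋆ g) m) (g m) ⟩
    (g ⋆ g) m + g m                              ∎
    where
    m = suc n
    g = tail invE
    h = g +ₛ ½ • δ

  -- The Riccati equation for c: x c′ + 2c = x/4 - x c².
  riccati-cCoeff : ∀ n → (cCoeff ⋆ cCoeff) (suc n) ≡ - ℕ→ℚ (4 ℕ.+ n) * cCoeff (2 ℕ.+ n)
  riccati-cCoeff n = begin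
    (cCoeff ⋆ cCoeff) (suc n)                     ≡⟨ cCoeff⋆cCoeff n ⟩
    t + g₂                                        ≡⟨ solve 3 (λ t g₂ g₃ → t :+ g₂ := (g₃ :+ g₃ :+ t) :- (g₃ :+ g₃) :+ g₂) refl t g₂ g₃ ⟩
    (g₃ + g₃ + t) - (g₃ + g₃) + g₂                ≡⟨ cong (λ x → x - (g₃ + g₃) + g₂) (invE⋆invE-uncons (suc n)) ⟨
    gg - (g₃ + g₃) + g₂                           ≡⟨ cong (λ x → x - (g₃ + g₃) + g₂) (solve 3 (λ gg g₂ g₃ → gg := g₃ :- g₂ :- (g₃ :- g₂ :- gg)) refl gg g₂ g₃)
                                                        ⟩
    (g₃ - g₂ - (g₃ - g₂ - gg)) - (g₃ + g₃) + g₂   ≡⟨ cong (λ x → (g₃ - g₂ - x) - (g₃ + g₃) + g₂) (θ-invE (3 ℕ.+ n)) ⟨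
    (g₃ - g₂ - k * g₃) - (g₃ + g₃) + g₂           ≡⟨ solve 3 (λ a g₂ g₃ → (g₃ :- g₂ :- a :* g₃) :- (g₃ :+ g₃) :+ g₂ := :- (con 1ℚ :+ a) :* g₃) refl k g₂ g₃ ⟩
    - (1ℚ + k) * g₃                               ≡⟨ cong (λ x → - x * g₃) (ℕ→ℚ-suc (3 ℕ.+ n)) ⟨
    - ℕ→ℚ (4 ℕ.+ n) * g₃                          ∎
    where
    t  = (tail invE ⋆ tail invE) (suc n)
    gg = (invE ⋆ invE) (3 ℕ.+ n)
    g₂ = invE (2 ℕ.+ n)
    g₃ = invE (3 ℕ.+ n)
    k  = ℕ→ℚ (3 ℕ.+ n)

  cCoeff-even-≤ : ∀ t s → s ℕ.≤ t → cCoeff (2 ℕ.* s) ≡ 0ℚ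
  cCoeff-even-≤ zero    .zero z≤n = refl
  cCoeff-even-≤ (suc t) s s≤1+t with ℕₚ.m≤n⇒m<n∨m≡n s≤1+t
  ... | inj₁ (s≤s s≤t) = cCoeff-even-≤ t s s≤t
  ... | inj₂ refl      = subst (λ i → cCoeff i ≡ 0ℚ) (sym (ℕₚ.*-suc 2 t))
    (-[1+n]*x≡0⇒x≡0 (3 ℕ.+ 2 ℕ.* t) (cCoeff (2 ℕ.+ 2 ℕ.* t))
      (trans (sym (riccati-cCoeff (2 ℕ.* t))) (Σ<-vanishing (2 ℕ.+ 2 ℕ.* t) term-vanishes)))
    where
    term-vanishes : ∀ j → j ℕ.< 2 ℕ.+ 2 ℕ.* t → cCoeff j * cCoeff (suc (2 ℕ.* t) ∸ j) ≡ 0ℚ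
    term-vanishes j j< with even-factor-of-odd-sum t j (ℕₚ.≤-pred j<)
    ... | s′ , s′≤t , inj₁ refl = trans (cong (_* cCoeff (suc (2 ℕ.* t) ∸ j)) (cCoeff-even-≤ t s′ s′≤t)) (*-zeroˡ (cCoeff (suc (2 ℕ.* t) ∸ j)))
    ... | s′ , s′≤t , inj₂ eq   = trans (cong (λ i → cCoeff j * cCoeff i) eq)
                                   (trans (cong (cCoeff j *_) (cCoeff-even-≤ t s′ s′≤t)) (*-zeroʳ (cCoeff j)))

  cCoeff-even : ∀ s → cCoeff (2 ℕ.* s) ≡ 0ℚ
  cCoeff-even s = cCoeff-even-≤ s s ℕₚ.≤-refl

  [-1]^i*cCoeff≡-cCoeff : ∀ i → (- 1ℚ) ^ i * cCoeff i ≡ - cCoeff i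
  [-1]^i*cCoeff≡-cCoeff i with even-or-odd i
  ... | s , inj₁ refl = begin
    (- 1ℚ) ^ (2 ℕ.* s) * cCoeff (2 ℕ.* s)  ≡⟨ cong₂ _*_ ([-1]^[2*s]≡1 s) (cCoeff-even s) ⟩
    1ℚ * 0ℚ                                ≡⟨ cong -_ (cCoeff-even s) ⟨
    - cCoeff (2 ℕ.* s)                     ∎
  ... | s , inj₂ refl = begin
    - 1ℚ * (- 1ℚ) ^ (2 ℕ.* s) * cᵢ    ≡⟨ cong (λ x → - 1ℚ * x * cᵢ) ([-1]^[2*s]≡1 s) ⟩
    - 1ℚ * 1ℚ * cᵢ                    ≡⟨ solve 1 (λ cᵢ → :- con 1ℚ :* con 1ℚ :* cᵢ := :- cᵢ) refl cᵢ ⟩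
    - cᵢ                              ∎
    where cᵢ = cCoeff (suc (2 ℕ.* s))

  -- Bernoulli numbers

  bernoulli-suc : ∀ m → bernoulli (suc m) ≡ - (inv (2 ℕ.+ m) * Σ< (suc m) (λ j → ℕ→ℚ ((2 ℕ.+ m) C j) * bernoulli j))
  bernoulli-suc m = trans (B.at-L-suc m) (cong (λ x → - (inv (2 ℕ.+ m) * x))
    (trans (Σ≤≡Σ< m (λ j → ℕ→ℚ ((2 ℕ.+ m) C j) * at (bernoulliList m) j))
           (Σ<-cong (suc m) (λ j j≤m → cong (ℕ→ℚ ((2 ℕ.+ m) C j) *_) (B.at-L-stable m j (ℕₚ.≤-pred j≤m))))))
    where module B = Growing bernoulliList refl _ (λ _ → refl)

  -- B_m/m! and invE satisfy the same recursion.
  bernoulli≡!*invE-≤ : ∀ m j → j ℕ.≤ m → bernoulli j ≡ ℕ→ℚ (j !) * invE j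
  bernoulli≡!*invE-≤ zero    .zero z≤n = refl
  bernoulli≡!*invE-≤ (suc m) j j≤1+m with ℕₚ.m≤n⇒m<n∨m≡n j≤1+m
  ... | inj₁ (s≤s j≤m) = bernoulli≡!*invE-≤ m j j≤m
  ... | inj₂ refl = begin
    bernoulli (suc m)
      ≡⟨ bernoulli-suc m ⟩
    - (inv N * Σ< (suc m) (λ j → ℕ→ℚ (N C j) * bernoulli j))
      ≡⟨ cong (λ x → - (inv N * x)) (Σ<-cong (suc m) (λ j j≤m → cong (ℕ→ℚ (N C j) *_) (bernoulli≡!*invE-≤ m j (ℕₚ.≤-pred j≤m)))) ⟩
    - (inv N * Σ< (suc m) (λ j → ℕ→ℚ (N C j) * (ℕ→ℚ (j !) * invE j)))
      ≡⟨ cong -_ (Σ<-*ˡ (suc m) (inv N) (λ j → ℕ→ℚ (N C j) * (ℕ→ℚ (j !) * invE j))) ⟨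
    - Σ< (suc m) (λ j → inv N * (ℕ→ℚ (N C j) * (ℕ→ℚ (j !) * invE j)))
      ≡⟨ cong -_ (Σ<-cong (suc m) (λ j j≤m → term j (ℕₚ.≤-pred j≤m))) ⟩
    - Σ< (suc m) (λ j → ℕ→ℚ (suc m !) * (invE j * E (suc (m ∸ j))))
      ≡⟨ cong -_ (Σ<-*ˡ (suc m) (ℕ→ℚ (suc m !)) (λ j → invE j * E (suc (m ∸ j)))) ⟩
    - (ℕ→ℚ (suc m !) * Σ< (suc m) (λ j → invE j * E (suc (m ∸ j))))
      ≡⟨ neg-distribʳ-* (ℕ→ℚ (suc m !)) _ ⟩
    ℕ→ℚ (suc m !) * - Σ< (suc m) (λ j → invE j * E (suc (m ∸ j)))
      ≡⟨ cong (λ x → ℕ→ℚ (suc m !) * - x) reversed ⟨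
    ℕ→ℚ (suc m !) * - Σ< (suc m) (λ i → invE (m ∸ i) * E (suc i))
      ≡⟨ cong (ℕ→ℚ (suc m !) *_) (invE-suc m) ⟨
    ℕ→ℚ (suc m !) * invE (suc m) ∎
    where
    N = 2 ℕ.+ m
    term : ∀ j → j ℕ.≤ m → inv N * (ℕ→ℚ (N C j) * (ℕ→ℚ (j !) * invE j)) ≡ ℕ→ℚ (suc m !) * (invE j * E (suc (m ∸ j)))
    term j j≤m = begin
      inv N * (ℕ→ℚ (N C j) * (ℕ→ℚ (j !) * invE j))
        ≡⟨ solve 4 (λ i c a g → i :* (c :* (a :* g)) := (i :* c :* a) :* g) refl (inv N) (ℕ→ℚ (N C j)) (ℕ→ℚ (j !)) (invE j) ⟩
      inv N * ℕ→ℚ (N C j) * ℕ→ℚ (j !) * invE j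
        ≡⟨ cong (_* invE j) ([1+m]Cj*j!/[1+m]≡m!/[1+m-j]! (suc m) j (ℕₚ.m≤n⇒m≤1+n (ℕₚ.m≤n⇒m≤1+n j≤m))) ⟩
      ℕ→ℚ (suc m !) * inv ((N ∸ j) !) * invE j
        ≡⟨ cong (λ k → ℕ→ℚ (suc m !) * inv (k !) * invE j) (ℕₚ.+-∸-assoc 2 j≤m) ⟩
      ℕ→ℚ (suc m !) * E (suc (m ∸ j)) * invE j
        ≡⟨ solve 3 (λ a e g → a :* e :* g := a :* (g :* e)) refl (ℕ→ℚ (suc m !)) (E (suc (m ∸ j))) (invE j) ⟩
      ℕ→ℚ (suc m !) * (invE j * E (suc (m ∸ j))) ∎
    reversed : Σ< (suc m) (λ i → invE (m ∸ i) * E (suc i)) ≡ Σ< (suc m) (λ j → invE j * E (suc (m ∸ j)))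
    reversed = trans (Σ<-reverse m (λ i → invE (m ∸ i) * E (suc i)))
      (Σ<-cong (suc m) (λ j j≤m → cong (λ k → invE k * E (suc (m ∸ j))) (ℕₚ.m∸[m∸n]≡n (ℕₚ.≤-pred j≤m))))

  bernoulli≡!*invE : ∀ m → bernoulli m ≡ ℕ→ℚ (m !) * invE m
  bernoulli≡!*invE m = bernoulli≡!*invE-≤ m m ℕₚ.≤-refl

  [1+n]!*cCoeff[1+n]≡B[2+n]/[2+n] : ∀ n → ℕ→ℚ (suc n !) * cCoeff (suc n) ≡ bernoulli (2 ℕ.+ n) * inv (2 ℕ.+ n)
  [1+n]!*cCoeff[1+n]≡B[2+n]/[2+n] n = begin
    ℕ→ℚ (suc n !) * c₊                                   ≡⟨ *-identityˡ _ ⟨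
    1ℚ * (ℕ→ℚ (suc n !) * c₊)                            ≡⟨ cong (_* (ℕ→ℚ (suc n !) * c₊)) (inv-inverseˡ (2 ℕ.+ n)) ⟨
    inv (2 ℕ.+ n) * ℕ→ℚ (2 ℕ.+ n) * (ℕ→ℚ (suc n !) * c₊)
      ≡⟨ solve 4 (λ i a f c → i :* a :* (f :* c) := a :* f :* c :* i) refl (inv (2 ℕ.+ n)) (ℕ→ℚ (2 ℕ.+ n)) (ℕ→ℚ (suc n !)) c₊ ⟩
    ℕ→ℚ (2 ℕ.+ n) * ℕ→ℚ (suc n !) * c₊ * inv (2 ℕ.+ n)   ≡⟨ cong (λ x → x * c₊ * inv (2 ℕ.+ n)) (ℕ→ℚ-* (2 ℕ.+ n) (suc n !)) ⟨
    ℕ→ℚ ((2 ℕ.+ n) !) * invE (2 ℕ.+ n) * inv (2 ℕ.+ n)  ≡⟨ cong (_* inv (2 ℕ.+ n)) (bernoulli≡!*invE (2 ℕ.+ n)) ⟨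
    bernoulli (2 ℕ.+ n) * inv (2 ℕ.+ n)                 ∎
    where c₊ = cCoeff (suc n)

  -- Coefficients of δ⁰Yⁿ(S) and of its translates

  coef-tabulate : ∀ n (h : ℕ → ℚ) i → i ℕ.≤ n → coef (tabulate {n = suc n} (h ∘ toℕ)) i ≡ h i
  coef-tabulate n       h zero    _         = refl
  coef-tabulate (suc n) h (suc i) (s≤s i≤n) = coef-tabulate n (h ∘ suc) i i≤n

  coef-zipWith : ∀ n (_∙_ : ℚ → ℚ → ℚ) (P Q : V n) i → i ℕ.≤ n → coef (zipWith _∙_ P Q) i ≡ coef P i ∙ coef Q i
  coef-zipWith n       _∙_ (x ∷ P) (y ∷ Q) zero    _         = refl
  coef-zipWith (suc n) _∙_ (x ∷ P) (y ∷ Q) (suc i) (s≤s i≤n) = coef-zipWith n _∙_ P Q i i≤n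

  coef-∣ : ∀ n (P : V n) a b c d k → k ℕ.≤ n → coef (P ∣ mat a b c d) k ≡
    Σ< (suc n) (λ i → coef P i * (linPowF (ℤ→ℚ a) (ℤ→ℚ b) i ⋆ linPowF (ℤ→ℚ c) (ℤ→ℚ d) (n ∸ i)) k)
  coef-∣ n P a b c d k k≤n = begin
    coef (P ∣ mat a b c d) k                   ≡⟨ coef-tabulate n (λ k → Σ≤ n (λ i → coef P i * convF (ℓ i) (r i) k)) k k≤n ⟩
    Σ≤ n (λ i → coef P i * convF (ℓ i) (r i) k) ≡⟨ Σ≤≡Σ< n (λ i → coef P i * convF (ℓ i) (r i) k) ⟩
    Σ< (suc n) (λ i → coef P i * convF (ℓ i) (r i) k)
      ≡⟨ Σ<-cong (suc n) (λ i _ → cong (coef P i *_) (Σ≤≡Σ< k (λ j → ℓ i j * r i (k ∸ j)))) ⟩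
    Σ< (suc n) (λ i → coef P i * (ℓ i ⋆ r i) k) ∎
    where
    ℓ r : ℕ → Series
    ℓ i = linPowF (ℤ→ℚ a) (ℤ→ℚ b) i
    r i = linPowF (ℤ→ℚ c) (ℤ→ℚ d) (n ∸ i)

  linPowF-zero : ∀ p q → linPowF p q 0 ≗ δ
  linPowF-zero p q zero    = refl
  linPowF-zero p q (suc j) = refl

  linPowF-≤ : ∀ p q i j → j ℕ.≤ i → linPowF p q i j ≡ ℕ→ℚ (i C j) * p ^ j * q ^ (i ∸ j)
  linPowF-≤ p q i j j≤i with j ≤ᵇ i | ℕₚ.≤⇒≤ᵇ j≤i
  ... | true | _ = refl

  nCk*δ[n-k]≡δ[n-k] : ∀ n k → k ℕ.≤ n → ℕ→ℚ (n C k) * δ (n ∸ k) ≡ δ (n ∸ k)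
  nCk*δ[n-k]≡δ[n-k] n k k≤n with ℕₚ.m≤n⇒m<n∨m≡n k≤n
  ... | inj₁ k<n = trans (cong (ℕ→ℚ (n C k) *_) (δ-∸-< k<n)) (trans (*-zeroʳ (ℕ→ℚ (n C k))) (sym (δ-∸-< k<n)))
  ... | inj₂ refl = trans (cong₂ (λ x i → ℕ→ℚ x * δ i) (nCn≡1 k) (ℕₚ.n∸n≡0 k)) (cong δ (sym (ℕₚ.n∸n≡0 k)))

  nCk*δk≡δk : ∀ n k → ℕ→ℚ (n C k) * δ k ≡ δ k
  nCk*δk≡δk n zero    = refl
  nCk*δk≡δk n (suc k) = *-zeroʳ (ℕ→ℚ (n C suc k))

  coef-[X+Y]ⁿ : ∀ n k → k ℕ.≤ n → linPowF 1ℚ 1ℚ n k ≡ ℕ→ℚ (n C k)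
  coef-[X+Y]ⁿ n k k≤n = begin
    linPowF 1ℚ 1ℚ n k                          ≡⟨ linPowF-≤ 1ℚ 1ℚ n k k≤n ⟩
    ℕ→ℚ (n C k) * 1ℚ ^ k * 1ℚ ^ (n ∸ k)        ≡⟨ cong₂ (λ x y → ℕ→ℚ (n C k) * x * y) (1^k≡1 k) (1^k≡1 (n ∸ k)) ⟩
    ℕ→ℚ (n C k) * 1ℚ * 1ℚ                      ≡⟨ trans (*-identityʳ _) (*-identityʳ _) ⟩
    ℕ→ℚ (n C k)                                ∎

  coef-[X-Y]ⁿ : ∀ n k → k ℕ.≤ n → linPowF 1ℚ (- 1ℚ) n k ≡ ℕ→ℚ (n C k) * (- 1ℚ) ^ (n ∸ k)
  coef-[X-Y]ⁿ n k k≤n = begin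
    linPowF 1ℚ (- 1ℚ) n k                      ≡⟨ linPowF-≤ 1ℚ (- 1ℚ) n k k≤n ⟩
    ℕ→ℚ (n C k) * 1ℚ ^ k * (- 1ℚ) ^ (n ∸ k)    ≡⟨ cong (λ x → ℕ→ℚ (n C k) * x * (- 1ℚ) ^ (n ∸ k)) (1^k≡1 k) ⟩
    ℕ→ℚ (n C k) * 1ℚ * (- 1ℚ) ^ (n ∸ k)        ≡⟨ cong (_* (- 1ℚ) ^ (n ∸ k)) (*-identityʳ (ℕ→ℚ (n C k))) ⟩
    ℕ→ℚ (n C k) * (- 1ℚ) ^ (n ∸ k)             ∎

  coef-Xⁿ : ∀ n k → k ℕ.≤ n → linPowF 1ℚ 0ℚ n k ≡ δ (n ∸ k)
  coef-Xⁿ n k k≤n = begin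
    linPowF 1ℚ 0ℚ n k                          ≡⟨ linPowF-≤ 1ℚ 0ℚ n k k≤n ⟩
    ℕ→ℚ (n C k) * 1ℚ ^ k * 0ℚ ^ (n ∸ k)        ≡⟨ cong₂ (λ x y → ℕ→ℚ (n C k) * x * y) (1^k≡1 k) (0^k≡δk (n ∸ k)) ⟩
    ℕ→ℚ (n C k) * 1ℚ * δ (n ∸ k)               ≡⟨ cong (_* δ (n ∸ k)) (*-identityʳ (ℕ→ℚ (n C k))) ⟩
    ℕ→ℚ (n C k) * δ (n ∸ k)                    ≡⟨ nCk*δ[n-k]≡δ[n-k] n k k≤n ⟩
    δ (n ∸ k)                                  ∎

  coef-Yⁿ : ∀ n k → k ℕ.≤ n → linPowF 0ℚ 1ℚ n k ≡ δ k
  coef-Yⁿ n k k≤n = begin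
    linPowF 0ℚ 1ℚ n k                          ≡⟨ linPowF-≤ 0ℚ 1ℚ n k k≤n ⟩
    ℕ→ℚ (n C k) * 0ℚ ^ k * 1ℚ ^ (n ∸ k)        ≡⟨ cong₂ (λ x y → ℕ→ℚ (n C k) * x * y) (0^k≡δk k) (1^k≡1 (n ∸ k)) ⟩
    ℕ→ℚ (n C k) * δ k * 1ℚ                     ≡⟨ *-identityʳ (ℕ→ℚ (n C k) * δ k) ⟩
    ℕ→ℚ (n C k) * δ k                          ≡⟨ nCk*δk≡δk n k ⟩
    δ k                                        ∎

  coef-Ypow : ∀ n i → i ℕ.≤ n → coef (Ypow n) i ≡ δ i
  coef-Ypow n i i≤n = trans (coef-tabulate n (λ i → if i ≤ᵇ 0 then 1ℚ else 0ℚ) i i≤n) (lemma i)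
    where
    lemma : ∀ i → (if i ≤ᵇ 0 then 1ℚ else 0ℚ) ≡ δ i
    lemma zero    = refl
    lemma (suc i) = refl

  coef-Ypow∣S : ∀ n k → k ℕ.≤ n → coef (Ypow n ∣ Smat) k ≡ δ (n ∸ k)
  coef-Ypow∣S n k k≤n = begin
    coef (Ypow n ∣ Smat) k
      ≡⟨ coef-∣ n (Ypow n) (ℤ.+ 0) (ℤ.- ℤ.+ 1) (ℤ.+ 1) (ℤ.+ 0) k k≤n ⟩
    Σ< (suc n) (λ i → coef (Ypow n) i * (linPowF 0ℚ (- 1ℚ) i ⋆ linPowF 1ℚ 0ℚ (n ∸ i)) k)
      ≡⟨ Σ<-cong (suc n) (λ i i≤n → cong (_* (linPowF 0ℚ (- 1ℚ) i ⋆ linPowF 1ℚ 0ℚ (n ∸ i)) k) (coef-Ypow n i (ℕₚ.≤-pred i≤n))) ⟩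
    Σ< (suc n) (λ i → δ i * (linPowF 0ℚ (- 1ℚ) i ⋆ linPowF 1ℚ 0ℚ (n ∸ i)) k)
      ≡⟨ Σ<-δ-first n (λ i → (linPowF 0ℚ (- 1ℚ) i ⋆ linPowF 1ℚ 0ℚ (n ∸ i)) k) ⟩
    (linPowF 0ℚ (- 1ℚ) 0 ⋆ linPowF 1ℚ 0ℚ n) k
      ≡⟨ ⋆-cong {g = linPowF 1ℚ 0ℚ n} (linPowF-zero 0ℚ (- 1ℚ)) (λ _ → refl) k ⟩
    (δ ⋆ linPowF 1ℚ 0ℚ n) k                    ≡⟨ ⋆-identityˡ (linPowF 1ℚ 0ℚ n) k ⟩
    linPowF 1ℚ 0ℚ n k                          ≡⟨ coef-Xⁿ n k k≤n ⟩
    δ (n ∸ k)                                  ∎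

  coef-δ⁰Yⁿ[S] : ∀ n k → k ℕ.≤ n → coef (δ⁰ (Ypow n) Smat) k ≡ δ (n ∸ k) - δ k
  coef-δ⁰Yⁿ[S] n k k≤n = trans (coef-zipWith n _-_ (Ypow n ∣ Smat) (Ypow n) k k≤n)
    (cong₂ _-_ (coef-Ypow∣S n k k≤n) (coef-Ypow n k k≤n))

  -- δ⁰Yⁿ(S) = Xⁿ - Yⁿ, which γ sends to (aX + bY)ⁿ - (cX + dY)ⁿ.
  coef-δ⁰Yⁿ[S]∣ : ∀ n a b c d k → k ℕ.≤ suc n → coef (δ⁰ (Ypow (suc n)) Smat ∣ mat a b c d) k ≡
    linPowF (ℤ→ℚ a) (ℤ→ℚ b) (suc n) k - linPowF (ℤ→ℚ c) (ℤ→ℚ d) (suc n) k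
  coef-δ⁰Yⁿ[S]∣ n a b c d k k≤n = begin
    coef (δ⁰ (Ypow (suc n)) Smat ∣ mat a b c d) k
      ≡⟨ coef-∣ (suc n) (δ⁰ (Ypow (suc n)) Smat) a b c d k k≤n ⟩
    Σ< (2 ℕ.+ n) (λ i → coef (δ⁰ (Ypow (suc n)) Smat) i * F i)
      ≡⟨ Σ<-cong (2 ℕ.+ n) (λ i i≤n → cong (_* F i) (coef-δ⁰Yⁿ[S] (suc n) i (ℕₚ.≤-pred i≤n))) ⟩
    Σ< (2 ℕ.+ n) (λ i → (δ (suc n ∸ i) - δ i) * F i)
      ≡⟨ Σ<-cong (2 ℕ.+ n) (λ i _ → solve 3 (λ x y f → (x :- y) :* f := x :* f :- y :* f) refl (δ (suc n ∸ i)) (δ i) (F i)) ⟩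
    Σ< (2 ℕ.+ n) (λ i → δ (suc n ∸ i) * F i - δ i * F i)
      ≡⟨ Σ<-- (2 ℕ.+ n) (λ i → δ (suc n ∸ i) * F i) (λ i → δ i * F i) ⟩
    Σ< (2 ℕ.+ n) (λ i → δ (suc n ∸ i) * F i) - Σ< (2 ℕ.+ n) (λ i → δ i * F i)
      ≡⟨ cong₂ _-_ (Σ<-δ-last (suc n) F) (Σ<-δ-first (suc n) F) ⟩
    F (suc n) - F 0
      ≡⟨ cong₂ _-_ (trans (cong (λ i → (ℓ (suc n) ⋆ r i) k) (ℕₚ.n∸n≡0 (suc n)))
                         (trans (⋆-cong {f = ℓ (suc n)} (λ _ → refl) (linPowF-zero (ℤ→ℚ c) (ℤ→ℚ d)) k) (⋆-identityʳ (ℓ (suc n)) k)))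
                  (trans (⋆-cong {g = r (suc n)} (linPowF-zero (ℤ→ℚ a) (ℤ→ℚ b)) (λ _ → refl) k) (⋆-identityˡ (r (suc n)) k)) ⟩
    ℓ (suc n) k - r (suc n) k ∎
    where
    ℓ r : ℕ → Series
    ℓ i = linPowF (ℤ→ℚ a) (ℤ→ℚ b) i
    r i = linPowF (ℤ→ℚ c) (ℤ→ℚ d) i
    F : ℕ → ℚ
    F i = (ℓ i ⋆ r (suc n ∸ i)) k

  coef-δ⁰Yⁿ[S]∣T : ∀ n k → k ℕ.≤ suc n → coef (δ⁰ (Ypow (suc n)) Smat ∣ Tmat) k ≡ ℕ→ℚ (suc n C k) - δ k
  coef-δ⁰Yⁿ[S]∣T n k k≤n = trans (coef-δ⁰Yⁿ[S]∣ n (ℤ.+ 1) (ℤ.+ 1) (ℤ.+ 0) (ℤ.+ 1) k k≤n)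
    (cong₂ _-_ (coef-[X+Y]ⁿ (suc n) k k≤n) (coef-Yⁿ (suc n) k k≤n))

  coef-δ⁰Yⁿ[S]∣T⁻¹ : ∀ n k → k ℕ.≤ suc n → coef (δ⁰ (Ypow (suc n)) Smat ∣ Tinv) k ≡ ℕ→ℚ (suc n C k) * (- 1ℚ) ^ (suc n ∸ k) - δ k
  coef-δ⁰Yⁿ[S]∣T⁻¹ n k k≤n = trans (coef-δ⁰Yⁿ[S]∣ n (ℤ.+ 1) (ℤ.- ℤ.+ 1) (ℤ.+ 0) (ℤ.+ 1) k k≤n)
    (cong₂ _-_ (coef-[X-Y]ⁿ (suc n) k k≤n) (coef-Yⁿ (suc n) k k≤n))

  -- The pairing

  -- ⟨_,_⟩ reads its second argument at the reflected index n - i.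
  coef-δ⁰Yⁿ[S]∣[T-T⁻¹]-reflected : ∀ n i → i ℕ.≤ suc n →
    coef ((δ⁰ (Ypow (suc n)) Smat ∣ Tmat) ⊖ (δ⁰ (Ypow (suc n)) Smat ∣ Tinv)) (suc n ∸ i) ≡ ℕ→ℚ (suc n C i) * (1ℚ - (- 1ℚ) ^ i)
  coef-δ⁰Yⁿ[S]∣[T-T⁻¹]-reflected n i i≤N = begin
    coef ((Q ∣ Tmat) ⊖ (Q ∣ Tinv)) (N ∸ i)
      ≡⟨ coef-zipWith N _-_ (Q ∣ Tmat) (Q ∣ Tinv) (N ∸ i) N-i≤N ⟩
    coef (Q ∣ Tmat) (N ∸ i) - coef (Q ∣ Tinv) (N ∸ i)
      ≡⟨ cong₂ _-_ (coef-δ⁰Yⁿ[S]∣T n (N ∸ i) N-i≤N) (coef-δ⁰Yⁿ[S]∣T⁻¹ n (N ∸ i) N-i≤N) ⟩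
    (ℕ→ℚ (N C (N ∸ i)) - δ (N ∸ i)) - (ℕ→ℚ (N C (N ∸ i)) * (- 1ℚ) ^ (N ∸ (N ∸ i)) - δ (N ∸ i))
      ≡⟨ cong₂ (λ x k → (ℕ→ℚ x - δ (N ∸ i)) - (ℕ→ℚ x * (- 1ℚ) ^ k - δ (N ∸ i))) (sym (nCk≡nC[n∸k] i≤N)) (ℕₚ.m∸[m∸n]≡n i≤N) ⟩
    (ℕ→ℚ (N C i) - δ (N ∸ i)) - (ℕ→ℚ (N C i) * (- 1ℚ) ^ i - δ (N ∸ i))
      ≡⟨ solve 3 (λ x z s → (x :- z) :- (x :* s :- z) := x :* (con 1ℚ :- s)) refl (ℕ→ℚ (N C i)) (δ (N ∸ i)) ((- 1ℚ) ^ i) ⟩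
    ℕ→ℚ (N C i) * (1ℚ - (- 1ℚ) ^ i) ∎
    where
    N = suc n
    Q = δ⁰ (Ypow N) Smat
    N-i≤N = ℕₚ.m∸n≤m N i

  coef-δ⁰Yⁿ[S]+δ⁰Yⁿ[S]∣T-reflected : ∀ n j → j ℕ.≤ suc n →
    coef (δ⁰ (Ypow (suc n)) Smat ⊕ (δ⁰ (Ypow (suc n)) Smat ∣ Tmat)) (suc n ∸ j) ≡ δ j + ℕ→ℚ (suc n C j) - ℕ→ℚ 2 * δ (suc n ∸ j)
  coef-δ⁰Yⁿ[S]+δ⁰Yⁿ[S]∣T-reflected n j j≤N = begin
    coef (Q ⊕ (Q ∣ Tmat)) (N ∸ j)
      ≡⟨ coef-zipWith N _+_ Q (Q ∣ Tmat) (N ∸ j) N-j≤N ⟩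
    coef Q (N ∸ j) + coef (Q ∣ Tmat) (N ∸ j)
      ≡⟨ cong₂ _+_ (coef-δ⁰Yⁿ[S] N (N ∸ j) N-j≤N) (coef-δ⁰Yⁿ[S]∣T n (N ∸ j) N-j≤N) ⟩
    (δ (N ∸ (N ∸ j)) - δ (N ∸ j)) + (ℕ→ℚ (N C (N ∸ j)) - δ (N ∸ j))
      ≡⟨ cong₂ (λ k x → (δ k - δ (N ∸ j)) + (ℕ→ℚ x - δ (N ∸ j))) (ℕₚ.m∸[m∸n]≡n j≤N) (sym (nCk≡nC[n∸k] j≤N)) ⟩
    (δ j - δ (N ∸ j)) + (ℕ→ℚ (N C j) - δ (N ∸ j))
      ≡⟨ solve 3 (λ y z x → (y :- z) :+ (x :- z) := y :+ x :- con (ℕ→ℚ 2) :* z) refl (δ j) (δ (N ∸ j)) (ℕ→ℚ (N C j)) ⟩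
    δ j + ℕ→ℚ (N C j) - ℕ→ℚ 2 * δ (N ∸ j) ∎
    where
    N = suc n
    Q = δ⁰ (Ypow N) Smat
    N-j≤N = ℕₚ.m∸n≤m N j

  pairing-e0S : ∀ n → ⟨ e0S (suc n) , (δ⁰ (Ypow (suc n)) Smat ∣ Tmat) ⊖ (δ⁰ (Ypow (suc n)) Smat ∣ Tinv) ⟩ ≡
    - ℕ→ℚ (suc n !) * (cCoeff ⋆ cCoeff) (suc n)
  pairing-e0S n = begin
    Σ≤ N term                                          ≡⟨ Σ≤≡Σ< N term ⟩
    Σ< (suc N) term                                    ≡⟨ Σ<-cong (suc N) (λ i i≤N → term≡ i (ℕₚ.≤-pred i≤N)) ⟩
    Σ< (suc N) (λ i → - F * (cCoeff i * cCoeff (N ∸ i))) ≡⟨ Σ<-*ˡ (suc N) (- F) (λ i → cCoeff i * cCoeff (N ∸ i)) ⟩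
    - F * (cCoeff ⋆ cCoeff) N                          ∎
    where
    N = suc n
    F = ℕ→ℚ (N !)
    W = (δ⁰ (Ypow N) Smat ∣ Tmat) ⊖ (δ⁰ (Ypow N) Smat ∣ Tinv)
    term : ℕ → ℚ
    term i = (- 1ℚ) ^ i * inv (N C i) * coef (e0S N) i * coef W (N ∸ i)
    term≡ : ∀ i → i ℕ.≤ N → term i ≡ - F * (cCoeff i * cCoeff (N ∸ i))
    term≡ i i≤N = begin
      term i
        ≡⟨ cong₂ (λ x y → s * ι * x * y) (coef-tabulate N (λ i → F * ½ * (cCoeff i * cCoeff (N ∸ i))) i i≤N)
                                          (coef-δ⁰Yⁿ[S]∣[T-T⁻¹]-reflected n i i≤N) ⟩
      s * ι * (F * ½ * (cᵢ * c′)) * (Cᵢ * (1ℚ - s))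
        ≡⟨ solve 7 (λ s ι f h c c′ Cᵢ → s :* ι :* (f :* h :* (c :* c′)) :* (Cᵢ :* (con 1ℚ :- s))
                                      := f :* h :* (ι :* Cᵢ) :* (s :* c :- s :* s :* c) :* c′) refl s ι F ½ cᵢ c′ Cᵢ ⟩
      F * ½ * (ι * Cᵢ) * (s * cᵢ - s * s * cᵢ) * c′
        ≡⟨ cong₂ (λ x y → F * ½ * x * y * c′) (inv[nCi]*nCi≡1 N i i≤N)
                 (cong₂ _-_ ([-1]^i*cCoeff≡-cCoeff i) (cong (_* cᵢ) ([-1]^i*[-1]^i≡1 i))) ⟩
      F * ½ * 1ℚ * (- cᵢ - 1ℚ * cᵢ) * c′
        ≡⟨ solve 3 (λ f c c′ → f :* con ½ :* con 1ℚ :* (:- c :- con 1ℚ :* c) :* c′ := :- f :* (c :* c′)) refl F cᵢ c′ ⟩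
      - F * (cᵢ * c′) ∎
      where
      s = (- 1ℚ) ^ i
      ι = inv (N C i)
      Cᵢ = ℕ→ℚ (N C i)
      cᵢ = cCoeff i
      c′ = cCoeff (N ∸ i)

  pairing-e0T : ∀ n → (- 1ℚ) ^ suc n ≡ 1ℚ →
    ⟨ e0T (suc n) , δ⁰ (Ypow (suc n)) Smat ⊕ (δ⁰ (Ypow (suc n)) Smat ∣ Tmat) ⟩ ≡
    ℕ→ℚ (suc n !) * ½ * cCoeff (2 ℕ.+ n) * (1ℚ + 1ℚ - ℕ→ℚ 2 * ℕ→ℚ (2 ℕ.+ n))
  pairing-e0T n [-1]^N≡1 = begin
    Σ≤ N term                                              ≡⟨ Σ≤≡Σ< N term ⟩
    Σ< (suc N) term                                        ≡⟨ Σ<-cong (suc N) (λ j j≤N → term≡ j (ℕₚ.≤-pred j≤N)) ⟩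
    Σ< (suc N) (λ j → K * (X j + Y j - ℕ→ℚ 2 * Z j))       ≡⟨ Σ<-*ˡ (suc N) K (λ j → X j + Y j - ℕ→ℚ 2 * Z j) ⟩
    K * Σ< (suc N) (λ j → X j + Y j - ℕ→ℚ 2 * Z j)
      ≡⟨ cong (K *_) (trans (Σ<-- (suc N) (λ j → X j + Y j) (λ j → ℕ→ℚ 2 * Z j))
                             (cong₂ _-_ (Σ<-+ (suc N) X Y) (Σ<-*ˡ (suc N) (ℕ→ℚ 2) Z))) ⟩
    K * (Σ< (suc N) X + Σ< (suc N) Y - ℕ→ℚ 2 * Σ< (suc N) Z)
      ≡⟨ cong₂ (λ x y → K * (x + y - ℕ→ℚ 2 * Σ< (suc N) Z)) (Σ[-1]^j*[1+N]Cj≡[-1]^m*NCm N N) (Σ<-δ-first N w) ⟩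
    K * ((- 1ℚ) ^ N * ℕ→ℚ (N C N) + w 0 - ℕ→ℚ 2 * Σ< (suc N) Z)
      ≡⟨ cong₂ (λ x y → K * (x + w 0 - ℕ→ℚ 2 * y)) first-term (trans (Σ<-δ-last N w) last-weight) ⟩
    K * (1ℚ + 1ℚ - ℕ→ℚ 2 * ℕ→ℚ (suc N)) ∎
    where
    N = suc n
    F = ℕ→ℚ (N !)
    c₊ = cCoeff (suc N)
    K = F * ½ * c₊
    R = δ⁰ (Ypow N) Smat ⊕ (δ⁰ (Ypow N) Smat ∣ Tmat)
    term w X Y Z : ℕ → ℚ
    term j = (- 1ℚ) ^ j * inv (N C j) * coef (e0T N) j * coef R (N ∸ j)
    w j = (- 1ℚ) ^ j * inv (N C j) * ℕ→ℚ (suc N C j)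
    X j = (- 1ℚ) ^ j * ℕ→ℚ (suc N C j)
    Y j = δ j * w j
    Z j = δ (N ∸ j) * w j
    first-term : (- 1ℚ) ^ N * ℕ→ℚ (N C N) ≡ 1ℚ
    first-term = trans (cong₂ (λ x k → x * ℕ→ℚ k) [-1]^N≡1 (nCn≡1 N)) (*-identityˡ 1ℚ)
    last-weight : w N ≡ ℕ→ℚ (suc N)
    last-weight = begin
      (- 1ℚ) ^ N * inv (N C N) * ℕ→ℚ (suc N C N)   ≡⟨ cong₂ (λ x k → x * inv k * ℕ→ℚ (suc N C N)) [-1]^N≡1 (nCn≡1 N) ⟩
      1ℚ * inv 1 * ℕ→ℚ (suc N C N)                 ≡⟨ cong (λ l → 1ℚ * inv 1 * ℕ→ℚ l) ([1+n]Cn≡1+n N) ⟩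
      1ℚ * inv 1 * ℕ→ℚ (suc N)                     ≡⟨ *-identityˡ (ℕ→ℚ (suc N)) ⟩
      ℕ→ℚ (suc N)                                  ∎
    term≡ : ∀ j → j ℕ.≤ N → term j ≡ K * (X j + Y j - ℕ→ℚ 2 * Z j)
    term≡ j j≤N = begin
      term j
        ≡⟨ cong₂ (λ x y → s * ι * x * y) (coef-tabulate N (λ j → F * ½ * (c₊ * ℕ→ℚ (suc N C j))) j j≤N)
                                          (coef-δ⁰Yⁿ[S]+δ⁰Yⁿ[S]∣T-reflected n j j≤N) ⟩
      s * ι * (F * ½ * (c₊ * C₊)) * (δ j + Cⱼ - ℕ→ℚ 2 * δ (N ∸ j))
        ≡⟨ solve 9 (λ s ι f h c C₊ y Cⱼ z → s :* ι :* (f :* h :* (c :* C₊)) :* (y :+ Cⱼ :- con (ℕ→ℚ 2) :* z)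
                    := f :* h :* c :* (s :* C₊ :* (ι :* Cⱼ) :+ y :* (s :* ι :* C₊) :- con (ℕ→ℚ 2) :* (z :* (s :* ι :* C₊))))
                 refl s ι F ½ c₊ C₊ (δ j) Cⱼ (δ (N ∸ j)) ⟩
      K * (s * C₊ * (ι * Cⱼ) + Y j - ℕ→ℚ 2 * Z j)
        ≡⟨ cong (λ x → K * (s * C₊ * x + Y j - ℕ→ℚ 2 * Z j)) (inv[nCi]*nCi≡1 N j j≤N) ⟩
      K * (s * C₊ * 1ℚ + Y j - ℕ→ℚ 2 * Z j)
        ≡⟨ cong (λ x → K * (x + Y j - ℕ→ℚ 2 * Z j)) (*-identityʳ (s * C₊)) ⟩
      K * (X j + Y j - ℕ→ℚ 2 * Z j) ∎
      where
      s = (- 1ℚ) ^ j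
      ι = inv (N C j)
      Cⱼ = ℕ→ℚ (N C j)
      C₊ = ℕ→ℚ (suc N C j)

  PairingFormula : ℕ → Set
  PairingFormula n = (e : Mat → V n) → e Smat ≡ e0S n → e Tmat ≡ e0T n →
    ⟦ e , δ⁰ (Ypow n) ⟧ ≡ ℕ→ℚ 3 * bernoulli (2 ℕ.+ n) * inv (2 ℕ.+ n)

  pairingFormula : ∀ n → (- 1ℚ) ^ suc n ≡ 1ℚ → PairingFormula (suc n)
  pairingFormula n [-1]^N≡1 e e[S] e[T] = begin
    ⟨ e Smat , W ⟩ - ℕ→ℚ 2 * ⟨ e Tmat , R ⟩
      ≡⟨ cong₂ (λ x y → ⟨ x , W ⟩ - ℕ→ℚ 2 * ⟨ y , R ⟩) e[S] e[T] ⟩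
    ⟨ e0S N , W ⟩ - ℕ→ℚ 2 * ⟨ e0T N , R ⟩
      ≡⟨ cong₂ (λ x y → x - ℕ→ℚ 2 * y) (pairing-e0S n) (pairing-e0T n [-1]^N≡1) ⟩
    - F * (cCoeff ⋆ cCoeff) N - ℕ→ℚ 2 * (F * ½ * c₊ * (1ℚ + 1ℚ - ℕ→ℚ 2 * a₂))
      ≡⟨ cong (λ x → - F * x - ℕ→ℚ 2 * (F * ½ * c₊ * (1ℚ + 1ℚ - ℕ→ℚ 2 * a₂))) (riccati-cCoeff n) ⟩
    - F * (- ℕ→ℚ (2 ℕ.+ (2 ℕ.+ n)) * c₊) - ℕ→ℚ 2 * (F * ½ * c₊ * (1ℚ + 1ℚ - ℕ→ℚ 2 * a₂))
      ≡⟨ cong (λ x → - F * (- x * c₊) - ℕ→ℚ 2 * (F * ½ * c₊ * (1ℚ + 1ℚ - ℕ→ℚ 2 * a₂))) (ℕ→ℚ-+ 2 (2 ℕ.+ n)) ⟩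
    - F * (- (ℕ→ℚ 2 + a₂) * c₊) - ℕ→ℚ 2 * (F * ½ * c₊ * (1ℚ + 1ℚ - ℕ→ℚ 2 * a₂))
      ≡⟨ solve 3 (λ f c a → :- f :* (:- (con (ℕ→ℚ 2) :+ a) :* c) :- con (ℕ→ℚ 2) :* (f :* con ½ :* c :* (con 1ℚ :+ con 1ℚ :- con (ℕ→ℚ 2) :* a))
                  := con (ℕ→ℚ 3) :* (a :* f :* c)) refl F c₊ a₂ ⟩
    ℕ→ℚ 3 * (a₂ * F * c₊)                      ≡⟨ cong (λ x → ℕ→ℚ 3 * (x * c₊)) (ℕ→ℚ-* (2 ℕ.+ n) (N !)) ⟨
    ℕ→ℚ 3 * (ℕ→ℚ (suc N !) * c₊)              ≡⟨ cong (ℕ→ℚ 3 *_) ([1+n]!*cCoeff[1+n]≡B[2+n]/[2+n] N) ⟩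
    ℕ→ℚ 3 * (bernoulli (2 ℕ.+ N) * inv (2 ℕ.+ N)) ≡⟨ *-assoc (ℕ→ℚ 3) (bernoulli (2 ℕ.+ N)) (inv (2 ℕ.+ N)) ⟨
    ℕ→ℚ 3 * bernoulli (2 ℕ.+ N) * inv (2 ℕ.+ N)   ∎
    where
    N = suc n
    F = ℕ→ℚ (N !)
    c₊ = cCoeff (suc N)
    a₂ = ℕ→ℚ (suc N)
    W = (δ⁰ (Ypow N) Smat ∣ Tmat) ⊖ (δ⁰ (Ypow N) Smat ∣ Tinv)
    R = δ⁰ (Ypow N) Smat ⊕ (δ⁰ (Ypow N) Smat ∣ Tmat)

  pairingFormula-even : ∀ t → PairingFormula (2 ℕ.* suc t)
  pairingFormula-even t = pairingFormula _ ([-1]^[2*s]≡1 (suc t))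

open import Data.Nat using (ℕ; suc; _≤_; _*_; _∸_; z≤n; s≤s)
open import Data.Nat.Properties using (*-distribˡ-∸)
import Data.Rational
open import Relation.Binary.PropositionalEquality using (_≡_; subst)

mainTheorem3 : (k : ℕ) → 2 ≤ k →
    (e : Mat → V (2 * k ∸ 2)) → IsCocycle e →
    e Smat ≡ e0S (2 * k ∸ 2) → e Tmat ≡ e0T (2 * k ∸ 2) →
    ⟦ e , δ⁰ (Ypow (2 * k ∸ 2)) ⟧ ≡ (ℕ→ℚ 3 Data.Rational.* bernoulli (2 * k)) Data.Rational.* inv (2 * k)
mainTheorem3 (suc (suc t)) (s≤s (s≤s z≤n)) e _ =
  subst PairingFormula (*-distribˡ-∸ 2 (suc (suc t)) 1) (pairingFormula-even t) e
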